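{- Let $t\in\mathcal T_v$. If $\mathrm{tr}_\emptyset(t)$ is strongly normalising for $\to_{\lambda v/o}$ and $\mathrm{sn}_\emptyset(t)$ holds, then $t$ is strongly normalising for $\to_{\lambda v/o}$.
   Context: $\mathcal T_v$ (memory terms) is generated by $t,u ::= x \mid \lambda x.t \mid t\,u \mid t[\_/u]$, where $t[\_/u]$ is a void jump binding no variable; $\mathrm{fv}(t[\_/u])=\mathrm{fv}(t)\cup\mathrm{fv}(u)$; terms modulo $\alpha$-conversion; $t\{x/u\}$ is capture-avoiding substitution. Contexts: $C ::= \Box \mid C\,v \mid v\,C \mid v[\_/C] \mid C[\_/v] \mid \lambda y.C$; boxed contexts: $B ::= t\,C \mid t[\_/C] \mid B\,t \mid B[\_/t] \mid \lambda y.B$. Rules of $\lambda v$: ($\beta$) $(\lambda x.t)L\,u\mapsto t\{x/u\}L$ if $x\in\mathrm{fv}(t)$; (dB) $(\lambda x.t)L\,u\mapsto t[\_/u]L$ if $x\notin\mathrm{fv}(t)$, where $L$ is a possibly empty list of void jumps; (h) $t[\_/u]\mapsto t[\_/u_1]\dots[\_/u_n]$ for any $n\ge0$ and any strict subterms $u_i$ of $u$ with $\mathrm{fv}(u_i)\subseteq\mathrm{fv}(u)$; (u) $B\langle t[\_/u]\rangle\mapsto B\langle t\rangle[\_/u]$ if $B$ binds no free variable of $u$. $\to_{\lambda v}$ is the contextual closure. $\equiv_o$ is the smallest equivalence closed under contexts containing $t[\_/s][\_/v]\sim t[\_/v][\_/s]$, $\lambda y.(t[\_/s])\sim(\lambda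 y.t)[\_/s]$ if $y\notin\mathrm{fv}(s)$, and $t[\_/s]\,v\sim(t\,v)[\_/s]$; $t\to_{\lambda v/o}u$ iff $t\equiv_o t'\to_{\lambda v}u'\equiv_o u$. For a set of variables $\Gamma$, the trunk is: $\mathrm{tr}_\Gamma(x)=x$, $\mathrm{tr}_\Gamma(t\,u)=\mathrm{tr}_\Gamma(t)\,u$, $\mathrm{tr}_\Gamma(\lambda x.t)=\lambda x.\mathrm{tr}_{\Gamma\cup\{x\}}(t)$, $\mathrm{tr}_\Gamma(t[\_/u])=\mathrm{tr}_\Gamma(t)$ if $\mathrm{fv}(u)\cap\Gamma=\emptyset$ and $\mathrm{tr}_\Gamma(t)[\_/u]$ otherwise. The predicate $\mathrm{sn}_\Gamma$: $\mathrm{sn}_\Gamma(x)$ is true, $\mathrm{sn}_\Gamma(t\,u)=\mathrm{sn}_\Gamma(t)$, $\mathrm{sn}_\Gamma(\lambda x.t)=\mathrm{sn}_{\Gamma\cup\{x\}}(t)$, $\mathrm{sn}_\Gamma(t[\_/u])$ is "$\mathrm{sn}_\Gamma(t)$ and $u$ is $\to_{\lambda v/o}$-strongly normalising" if $\mathrm{fv}(u)\cap\Gamma=\emptyset$, and $\mathrm{sn}_\Gamma(t)$ otherwise. -}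

module Defs where

open import Data.Nat using (ℕ; zero; suc; _+_; _<ᵇ_; _∸_; pred)
open import Data.Bool using (Bool; true; false; if_then_else_; _∨_)
open import Data.List using (List; []; _∷_)
open import Data.List.Relation.Unary.All using (All)
open import Data.Product using (Σ; _×_; ∃; ∃-syntax; _,_)
open import Data.Unit using (⊤)
open import Relation.Nullary using (¬_)
open import Relation.Binary.PropositionalEquality using (_≡_)
open import Induction.WellFounded using (Acc)

-- Memory terms T_v, with de Bruijn indices (so terms are taken modulo
-- α-conversion by construction).  `jmp t u` is the void jump t[_/u].

data Tm : Set where
  var : ℕ → Tm
  lam : Tm → Tm
  app : Tm → Tm → Tm
  jmp : Tm → Tm → Tm

data _∈fv_ : ℕ → Tm → Set where
  fv-var  : ∀ {x} → x ∈fv var x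
  fv-lam  : ∀ {x t} → suc x ∈fv t → x ∈fv lam t
  fv-appˡ : ∀ {x t u} → x ∈fv t → x ∈fv app t u
  fv-appʳ : ∀ {x t u} → x ∈fv u → x ∈fv app t u
  fv-jmpˡ : ∀ {x t u} → x ∈fv t → x ∈fv jmp t u
  fv-jmpʳ : ∀ {x t u} → x ∈fv u → x ∈fv jmp t u

ext : (ℕ → ℕ) → ℕ → ℕ
ext ρ zero    = zero
ext ρ (suc k) = suc (ρ k)

ren : (ℕ → ℕ) → Tm → Tm
ren ρ (var k)   = var (ρ k)
ren ρ (lam t)   = lam (ren (ext ρ) t)
ren ρ (app t u) = app (ren ρ t) (ren ρ u)
ren ρ (jmp t u) = jmp (ren ρ t) (ren ρ u)

exts : (ℕ → Tm) → ℕ → Tm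
exts σ zero    = var zero
exts σ (suc k) = ren suc (σ k)

sub : (ℕ → Tm) → Tm → Tm
sub σ (var k)   = σ k
sub σ (lam t)   = lam (sub (exts σ) t)
sub σ (app t u) = app (sub σ t) (sub σ u)
sub σ (jmp t u) = jmp (sub σ t) (sub σ u)

_[0≔_] : Tm → Tm → Tm
t [0≔ u ] = sub σ t
  where
  σ : ℕ → Tm
  σ zero    = u
  σ (suc k) = var k

-- removing an unused binder (used only when 0 ∉fv t)
lower : Tm → Tm
lower = ren pred

-- weaken d u : u seen under d further binders, none of which it uses
weaken : ℕ → Tm → Tm
weaken d = ren (d +_)

-- t L  for a list L of void jumps: t[_/u₁]…[_/uₙ]
_⟪_⟫ : Tm → List Tm → Tm
t ⟪ [] ⟫    = t
t ⟪ u ∷ L ⟫ = jmp t u ⟪ L ⟫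

-- Subterms.  SubAt d s u : s occurs in u under exactly d binders of u.
data SubAt : ℕ → Tm → Tm → Set where
  here  : ∀ {t} → SubAt 0 t t
  in-lam  : ∀ {d s t} → SubAt d s t → SubAt (suc d) s (lam t)
  in-appˡ : ∀ {d s t u} → SubAt d s t → SubAt d s (app t u)
  in-appʳ : ∀ {d s t u} → SubAt d s u → SubAt d s (app t u)
  in-jmpˡ : ∀ {d s t u} → SubAt d s t → SubAt d s (jmp t u)
  in-jmpʳ : ∀ {d s t u} → SubAt d s u → SubAt d s (jmp t u)

data StrictSubAt : ℕ → Tm → Tm → Set where
  s-lam  : ∀ {d s t} → SubAt d s t → StrictSubAt (suc d) s (lam t)
  s-appˡ : ∀ {d s t u} → SubAt d s t → StrictSubAt d s (app t u)
  s-appʳ : ∀ {d s t u} → SubAt d s u → StrictSubAt d s (app t u)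
  s-jmpˡ : ∀ {d s t u} → SubAt d s t → StrictSubAt d s (jmp t u)
  s-jmpʳ : ∀ {d s t u} → SubAt d s u → StrictSubAt d s (jmp t u)

-- v is a strict subterm of u with fv(v) ⊆ fv(u): an occurrence under d
-- binders of u that uses none of those d binders, i.e. equals weaken d v.
StrictSubFv : Tm → Tm → Set
StrictSubFv v u = ∃[ d ] StrictSubAt d (weaken d v) u

data Ctx : Set where
  □     : Ctx
  appCˡ : Ctx → Tm → Ctx
  appCʳ : Tm → Ctx → Ctx
  jmpCʳ : Tm → Ctx → Ctx
  jmpCˡ : Ctx → Tm → Ctx
  lamC  : Ctx → Ctx

_⟨_⟩ : Ctx → Tm → Tm
□ ⟨ t ⟩         = t
appCˡ C v ⟨ t ⟩ = app (C ⟨ t ⟩) v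
appCʳ v C ⟨ t ⟩ = app v (C ⟨ t ⟩)
jmpCʳ v C ⟨ t ⟩ = jmp v (C ⟨ t ⟩)
jmpCˡ C v ⟨ t ⟩ = jmp (C ⟨ t ⟩) v
lamC C ⟨ t ⟩    = lam (C ⟨ t ⟩)

depthC : Ctx → ℕ
depthC □           = 0
depthC (appCˡ C _) = depthC C
depthC (appCʳ _ C) = depthC C
depthC (jmpCʳ _ C) = depthC C
depthC (jmpCˡ C _) = depthC C
depthC (lamC C)    = suc (depthC C)

data BCtx : Set where
  appBʳ : Tm → Ctx → BCtx
  jmpBʳ : Tm → Ctx → BCtx
  appBˡ : BCtx → Tm → BCtx
  jmpBˡ : BCtx → Tm → BCtx
  lamB  : BCtx → BCtx

_⟨_⟩B : BCtx → Tm → Tm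
appBʳ t C ⟨ s ⟩B = app t (C ⟨ s ⟩)
jmpBʳ t C ⟨ s ⟩B = jmp t (C ⟨ s ⟩)
appBˡ B t ⟨ s ⟩B = app (B ⟨ s ⟩B) t
jmpBˡ B t ⟨ s ⟩B = jmp (B ⟨ s ⟩B) t
lamB B ⟨ s ⟩B    = lam (B ⟨ s ⟩B)

depthB : BCtx → ℕ
depthB (appBʳ _ C) = depthC C
depthB (jmpBʳ _ C) = depthC C
depthB (appBˡ B _) = depthB B
depthB (jmpBˡ B _) = depthB B
depthB (lamB B)    = suc (depthB B)

infix 4 _↦_ _⟶_ _~o_ _≡o_ _⟶o_

data _↦_ : Tm → Tm → Set where
  β  : ∀ {t L u} → 0 ∈fv t →
       app (lam t ⟪ L ⟫) u ↦ (t [0≔ u ]) ⟪ L ⟫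
  dB : ∀ {t L u} → ¬ (0 ∈fv t) →
       app (lam t ⟪ L ⟫) u ↦ jmp (lower t) u ⟪ L ⟫
  h  : ∀ {t u us} → All (λ v → StrictSubFv v u) us →
       jmp t u ↦ t ⟪ us ⟫
  -- B binds no free variable of u: the jump at the hole is weaken (depthB B) u
  ur : ∀ (B : BCtx) {t u} →
       (B ⟨ jmp t (weaken (depthB B) u) ⟩B) ↦ jmp (B ⟨ t ⟩B) u

data _⟶_ : Tm → Tm → Set where
  ctx : ∀ (C : Ctx) {t u} → t ↦ u → (C ⟨ t ⟩) ⟶ (C ⟨ u ⟩)

data _~o_ : Tm → Tm → Set where
  ax-comm : ∀ {t s v} → jmp (jmp t s) v ~o jmp (jmp t v) s
  ax-lam  : ∀ {t s} → lam (jmp t (weaken 1 s)) ~o jmp (lam t) s   -- y ∉ fv(s)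
  ax-app  : ∀ {t s v} → app (jmp t s) v ~o jmp (app t v) s

data _≡o_ : Tm → Tm → Set where
  o-refl  : ∀ {t} → t ≡o t
  o-sym   : ∀ {t u} → t ≡o u → u ≡o t
  o-trans : ∀ {t u v} → t ≡o u → u ≡o v → t ≡o v
  o-ctx   : ∀ (C : Ctx) {t u} → t ~o u → (C ⟨ t ⟩) ≡o (C ⟨ u ⟩)

_⟶o_ : Tm → Tm → Set
t ⟶o u = ∃[ t' ] ∃[ u' ] (t ≡o t' × t' ⟶ u' × u' ≡o u)

SN : Tm → Set
SN = Acc (λ u t → t ⟶o u)

-- Γ is always {the d innermost bound variables} = de Bruijn indices < d.
-- meetsΓ d c u : u (under c local binders) has a free variable in Γ
meetsΓ : ℕ → ℕ → Tm → Bool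
meetsΓ d c (var k)   = if k <ᵇ c then false else ((k ∸ c) <ᵇ d)
meetsΓ d c (lam t)   = meetsΓ d (suc c) t
meetsΓ d c (app t u) = meetsΓ d c t ∨ meetsΓ d c u
meetsΓ d c (jmp t u) = meetsΓ d c t ∨ meetsΓ d c u

tr : ℕ → Tm → Tm
tr d (var x)   = var x
tr d (app t u) = app (tr d t) u
tr d (lam t)   = lam (tr (suc d) t)
tr d (jmp t u) = if meetsΓ d 0 u then jmp (tr d t) u else tr d t

sn : ℕ → Tm → Set
sn d (var x)   = ⊤
sn d (app t u) = sn d t
sn d (lam t)   = sn (suc d) t
sn d (jmp t u) = if meetsΓ d 0 u then sn d t else (sn d t × SN u)

-- A term t is ≡o-equivalent to its trunk tr t followed by the jumps [_/u] that
-- the trunk drops, and sn 0 t says precisely that these u are strongly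
-- normalising.  So it suffices that s[_/u] is strongly normalising whenever s
-- and u are.  Modulo ≡o the jump may slide along the spine of s; a step from
-- such a term either reduces s, reduces u, or consumes the jump, leaving jumps
-- on strict subterms of u (rule h) or the jumps [_/u′][_/w] with u → u′ and w a
-- strict subterm of u (rule u acting inside u).  The proof is therefore a
-- lexicographic induction on the strong normalisation of a term G from which u
-- is reached by steps and strict subterms, the size of u, and the strong
-- normalisation of s.
module Submission where

open import Defs
open import Data.Nat using (ℕ; zero; suc; _+_; pred; _<_; _≤_; _<ᵇ_; z≤n; s≤s)
open import Data.Nat.Properties
  using (suc-injective; +-suc; +-assoc; +-comm; +-cancelˡ-≡; m+n∸m≡n; m≤m+n; m≤n+m; m≤n⇒m≤1+n;
         ≤-refl; ≤-trans; ≤-<-trans; <-irrefl; <ᵇ⇒<; <⇒<ᵇ)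
open import Data.Nat.Induction using (<-wellFounded)
open import Data.Bool using (true; false; _∨_; T)
open import Data.List using (List; []; _∷_; _++_; map)
open import Data.List.Properties using (map-++)
open import Data.List.Relation.Unary.All as All using (All; []; _∷_)
open import Data.List.Relation.Unary.All.Properties using (++⁺; map⁺)
open import Data.Product using (_×_; ∃-syntax; _,_; proj₁)
open import Data.Sum using (_⊎_; inj₁; inj₂)
open import Data.Empty using (⊥; ⊥-elim)
open import Data.Unit using (tt)
open import Relation.Nullary using (¬_)
open import Relation.Binary.PropositionalEquality
open import Induction.WellFounded using (Acc; acc)

-- Renaming, substitution and free variables

ext-cong : ∀ {f g} → (∀ n → f n ≡ g n) → ∀ n → ext f n ≡ ext g n
ext-cong e zero    = refl
ext-cong e (suc n) = cong suc (e n)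

ren-ren : ∀ {f g fg} → (∀ n → f (g n) ≡ fg n) → ∀ t → ren f (ren g t) ≡ ren fg t
ren-ren e (var x)   = cong var (e x)
ren-ren {f} {g} {fg} e (lam t) = cong lam (ren-ren e′ t)
  where
  e′ : ∀ n → ext f (ext g n) ≡ ext fg n
  e′ zero    = refl
  e′ (suc n) = cong suc (e n)
ren-ren e (app t u) = cong₂ app (ren-ren e t) (ren-ren e u)
ren-ren e (jmp t u) = cong₂ jmp (ren-ren e t) (ren-ren e u)

sub-cong : ∀ {σ τ} → (∀ n → σ n ≡ τ n) → ∀ t → sub σ t ≡ sub τ t
sub-cong e (var x)   = e x
sub-cong {σ} {τ} e (lam t) = cong lam (sub-cong e′ t)
  where
  e′ : ∀ n → exts σ n ≡ exts τ n
  e′ zero    = refl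
  e′ (suc n) = cong (ren suc) (e n)
sub-cong e (app t u) = cong₂ app (sub-cong e t) (sub-cong e u)
sub-cong e (jmp t u) = cong₂ jmp (sub-cong e t) (sub-cong e u)

sub-ren : ∀ {σ ρ τ} → (∀ n → σ (ρ n) ≡ τ n) → ∀ t → sub σ (ren ρ t) ≡ sub τ t
sub-ren e (var x)   = e x
sub-ren {σ} {ρ} {τ} e (lam t) = cong lam (sub-ren e′ t)
  where
  e′ : ∀ n → exts σ (ext ρ n) ≡ exts τ n
  e′ zero    = refl
  e′ (suc n) = cong (ren suc) (e n)
sub-ren e (app t u) = cong₂ app (sub-ren e t) (sub-ren e u)
sub-ren e (jmp t u) = cong₂ jmp (sub-ren e t) (sub-ren e u)

ren-sub : ∀ {ρ σ τ} → (∀ n → ren ρ (σ n) ≡ τ n) → ∀ t → ren ρ (sub σ t) ≡ sub τ t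
ren-sub e (var x)   = e x
ren-sub {ρ} {σ} {τ} e (lam t) = cong lam (ren-sub e′ t)
  where
  e′ : ∀ n → ren (ext ρ) (exts σ n) ≡ exts τ n
  e′ zero    = refl
  e′ (suc n) = trans (ren-ren (λ _ → refl) (σ n))
                     (trans (sym (ren-ren (λ _ → refl) (σ n))) (cong (ren suc) (e n)))
ren-sub e (app t u) = cong₂ app (ren-sub e t) (ren-sub e u)
ren-sub e (jmp t u) = cong₂ jmp (ren-sub e t) (ren-sub e u)

sub-var≡ren : ∀ {σ f} → (∀ n → σ n ≡ var (f n)) → ∀ t → sub σ t ≡ ren f t
sub-var≡ren e (var x)   = e x
sub-var≡ren {σ} {f} e (lam t) = cong lam (sub-var≡ren e′ t)
  where
  e′ : ∀ n → exts σ n ≡ var (ext f n)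
  e′ zero    = refl
  e′ (suc n) = cong (ren suc) (e n)
sub-var≡ren e (app t u) = cong₂ app (sub-var≡ren e t) (sub-var≡ren e u)
sub-var≡ren e (jmp t u) = cong₂ jmp (sub-var≡ren e t) (sub-var≡ren e u)

single : Tm → ℕ → Tm
single u zero    = u
single u (suc k) = var k

[0≔]≡sub-single : ∀ t u → t [0≔ u ] ≡ sub (single u) t
[0≔]≡sub-single t u = sub-cong (λ { zero → refl ; (suc n) → refl }) t

ren-[0≔] : ∀ f t u → ren f (t [0≔ u ]) ≡ ren (ext f) t [0≔ ren f u ]
ren-[0≔] f t u = begin
  ren f (t [0≔ u ])                           ≡⟨ cong (ren f) ([0≔]≡sub-single t u) ⟩
  ren f (sub (single u) t)                    ≡⟨ ren-sub (λ { zero → refl ; (suc n) → refl }) t ⟩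
  sub (λ n → single (ren f u) (ext f n)) t    ≡⟨ sub-ren (λ _ → refl) t ⟨
  sub (single (ren f u)) (ren (ext f) t)      ≡⟨ [0≔]≡sub-single (ren (ext f) t) (ren f u) ⟨
  ren (ext f) t [0≔ ren f u ]                 ∎
  where open ≡-Reasoning

-- Two presentations of the d-fold iterate of ext: extⁿ unfolds as a renaming
-- descends through a context, extⁿ′ as it descends through a term.
extⁿ : ℕ → (ℕ → ℕ) → ℕ → ℕ
extⁿ zero    f = f
extⁿ (suc d) f = extⁿ d (ext f)

extⁿ′ : ℕ → (ℕ → ℕ) → ℕ → ℕ
extⁿ′ zero    f = f
extⁿ′ (suc c) f = ext (extⁿ′ c f)

extⁿ-ext : ∀ d f n → extⁿ d (ext f) n ≡ ext (extⁿ d f) n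
extⁿ-ext zero    f n = refl
extⁿ-ext (suc d) f n = extⁿ-ext d (ext f) n

extⁿ-< : ∀ d f n → n < d → extⁿ d f n ≡ n
extⁿ-< (suc d) f n n<d = trans (extⁿ-ext d f n) (ext-< n n<d)
  where
  ext-< : ∀ n → n < suc d → ext (extⁿ d f) n ≡ n
  ext-< zero    _         = refl
  ext-< (suc n) (s≤s n<d) = cong suc (extⁿ-< d f n n<d)

extⁿ-+ : ∀ d f n → extⁿ d f (d + n) ≡ d + f n
extⁿ-+ zero    f n = refl
extⁿ-+ (suc d) f n = trans (extⁿ-ext d f (suc (d + n))) (cong suc (extⁿ-+ d f n))

extⁿ′≗extⁿ : ∀ c f n → extⁿ′ c f n ≡ extⁿ c f n
extⁿ′≗extⁿ zero    f n = refl
extⁿ′≗extⁿ (suc c) f n = trans (ext-cong (extⁿ′≗extⁿ c f) n) (sym (extⁿ-ext c f n))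

extⁿ′-< : ∀ c f n → n < c → extⁿ′ c f n ≡ n
extⁿ′-< c f n n<c = trans (extⁿ′≗extⁿ c f n) (extⁿ-< c f n n<c)

extⁿ′-+ : ∀ c f n → extⁿ′ c f (c + n) ≡ c + f n
extⁿ′-+ c f n = trans (extⁿ′≗extⁿ c f (c + n)) (extⁿ-+ c f n)

ren-weaken : ∀ d f z → ren (extⁿ d f) (weaken d z) ≡ weaken d (ren f z)
ren-weaken d f z = trans (ren-ren (extⁿ-+ d f) z) (sym (ren-ren (λ _ → refl) z))

weaken₁-weaken : ∀ k v → weaken 1 (weaken k v) ≡ weaken (suc k) v
weaken₁-weaken k v = ren-ren (λ _ → refl) v

weaken-weaken₁ : ∀ n u → weaken n (weaken 1 u) ≡ weaken (suc n) u
weaken-weaken₁ n u = ren-ren (+-suc n) u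

map-weaken-suc : ∀ k L → map (weaken (suc k)) L ≡ map (weaken 1) (map (weaken k) L)
map-weaken-suc k []      = refl
map-weaken-suc k (u ∷ L) = cong₂ _∷_ (sym (weaken₁-weaken k u)) (map-weaken-suc k L)

var-injective : ∀ {a c} → var a ≡ var c → a ≡ c
var-injective refl = refl

lam-injective : ∀ {a c} → lam a ≡ lam c → a ≡ c
lam-injective refl = refl

app-injective : ∀ {a b c d} → app a b ≡ app c d → a ≡ c × b ≡ d
app-injective refl = refl , refl

jmp-injective : ∀ {a b c d} → jmp a b ≡ jmp c d → a ≡ c × b ≡ d
jmp-injective refl = refl , refl

ext-injective : ∀ {f} → (∀ {m n} → f m ≡ f n → m ≡ n) → ∀ {m n} → ext f m ≡ ext f n → m ≡ n
ext-injective f-inj {zero}  {zero}  e = refl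
ext-injective f-inj {suc m} {suc n} e = cong suc (f-inj (suc-injective e))

ren-injective : ∀ {f} → (∀ {m n} → f m ≡ f n → m ≡ n) → ∀ a b → ren f a ≡ ren f b → a ≡ b
ren-injective f-inj (var x)    (var y)    e = cong var (f-inj (var-injective e))
ren-injective f-inj (lam a)    (lam b)    e = cong lam (ren-injective (ext-injective f-inj) a b (lam-injective e))
ren-injective f-inj (app a a′) (app b b′) e =
  let e₁ , e₂ = app-injective e in cong₂ app (ren-injective f-inj a b e₁) (ren-injective f-inj a′ b′ e₂)
ren-injective f-inj (jmp a a′) (jmp b b′) e =
  let e₁ , e₂ = jmp-injective e in cong₂ jmp (ren-injective f-inj a b e₁) (ren-injective f-inj a′ b′ e₂)

fv-ren : ∀ {f x} t → x ∈fv t → f x ∈fv ren f t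
fv-ren (var x)   fv-var      = fv-var
fv-ren (lam t)   (fv-lam p)  = fv-lam (fv-ren t p)
fv-ren (app t u) (fv-appˡ p) = fv-appˡ (fv-ren t p)
fv-ren (app t u) (fv-appʳ p) = fv-appʳ (fv-ren u p)
fv-ren (jmp t u) (fv-jmpˡ p) = fv-jmpˡ (fv-ren t p)
fv-ren (jmp t u) (fv-jmpʳ p) = fv-jmpʳ (fv-ren u p)

fv-ren⁻ : ∀ {f y} t → y ∈fv ren f t → ∃[ x ] (x ∈fv t × f x ≡ y)
fv-ren⁻ (var x) fv-var = x , fv-var , refl
fv-ren⁻ {f} (lam t) (fv-lam p) with fv-ren⁻ {ext f} t p
... | suc x , q , e = x , fv-lam q , suc-injective e
fv-ren⁻ (app t u) (fv-appˡ p) = let x , q , e = fv-ren⁻ t p in x , fv-appˡ q , e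
fv-ren⁻ (app t u) (fv-appʳ p) = let x , q , e = fv-ren⁻ u p in x , fv-appʳ q , e
fv-ren⁻ (jmp t u) (fv-jmpˡ p) = let x , q , e = fv-ren⁻ t p in x , fv-jmpˡ q , e
fv-ren⁻ (jmp t u) (fv-jmpʳ p) = let x , q , e = fv-ren⁻ u p in x , fv-jmpʳ q , e

fv₀-ren-ext⁻ : ∀ {f} t → 0 ∈fv ren (ext f) t → 0 ∈fv t
fv₀-ren-ext⁻ {f} t p with fv-ren⁻ {ext f} t p
... | zero , q , _ = q

ren-cong-fv : ∀ {f g} t → (∀ x → x ∈fv t → f x ≡ g x) → ren f t ≡ ren g t
ren-cong-fv (var x)   e = cong var (e x fv-var)
ren-cong-fv {f} {g} (lam t) e = cong lam (ren-cong-fv t e′)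
  where
  e′ : ∀ x → x ∈fv t → ext f x ≡ ext g x
  e′ zero    _ = refl
  e′ (suc x) p = cong suc (e x (fv-lam p))
ren-cong-fv (app t u) e = cong₂ app (ren-cong-fv t (λ x p → e x (fv-appˡ p))) (ren-cong-fv u (λ x p → e x (fv-appʳ p)))
ren-cong-fv (jmp t u) e = cong₂ jmp (ren-cong-fv t (λ x p → e x (fv-jmpˡ p))) (ren-cong-fv u (λ x p → e x (fv-jmpʳ p)))

lower-ren-ext : ∀ f t → ¬ (0 ∈fv t) → lower (ren (ext f) t) ≡ ren f (lower t)
lower-ren-ext f t 0∉t =
  trans (ren-ren (λ _ → refl) t) (trans (ren-cong-fv t pred-ext) (sym (ren-ren (λ _ → refl) t)))
  where
  pred-ext : ∀ x → x ∈fv t → pred (ext f x) ≡ f (pred x)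
  pred-ext zero    p = ⊥-elim (0∉t p)
  pred-ext (suc x) p = refl

-- Contexts

_∘C_ : Ctx → Ctx → Ctx
□         ∘C D = D
appCˡ C v ∘C D = appCˡ (C ∘C D) v
appCʳ v C ∘C D = appCʳ v (C ∘C D)
jmpCʳ v C ∘C D = jmpCʳ v (C ∘C D)
jmpCˡ C v ∘C D = jmpCˡ (C ∘C D) v
lamC C    ∘C D = lamC (C ∘C D)

⟨⟩-∘C : ∀ C D t → (C ∘C D) ⟨ t ⟩ ≡ C ⟨ D ⟨ t ⟩ ⟩
⟨⟩-∘C □           D t = refl
⟨⟩-∘C (appCˡ C v) D t = cong (λ z → app z v) (⟨⟩-∘C C D t)
⟨⟩-∘C (appCʳ v C) D t = cong (app v) (⟨⟩-∘C C D t)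
⟨⟩-∘C (jmpCʳ v C) D t = cong (jmp v) (⟨⟩-∘C C D t)
⟨⟩-∘C (jmpCˡ C v) D t = cong (λ z → jmp z v) (⟨⟩-∘C C D t)
⟨⟩-∘C (lamC C)    D t = cong lam (⟨⟩-∘C C D t)

jumpsC : List Tm → Ctx
jumpsC []      = □
jumpsC (u ∷ L) = jumpsC L ∘C jmpCˡ □ u

jumpsC-⟨⟩ : ∀ L t → jumpsC L ⟨ t ⟩ ≡ t ⟪ L ⟫
jumpsC-⟨⟩ []      t = refl
jumpsC-⟨⟩ (u ∷ L) t = trans (⟨⟩-∘C (jumpsC L) (jmpCˡ □ u) t) (jumpsC-⟨⟩ L (jmp t u))

⟪⟫-++ : ∀ t L₁ L₂ → t ⟪ L₁ ++ L₂ ⟫ ≡ (t ⟪ L₁ ⟫) ⟪ L₂ ⟫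
⟪⟫-++ t []       L₂ = refl
⟪⟫-++ t (u ∷ L₁) L₂ = ⟪⟫-++ (jmp t u) L₁ L₂

renC : (ℕ → ℕ) → Ctx → Ctx
renC f □           = □
renC f (appCˡ C v) = appCˡ (renC f C) (ren f v)
renC f (appCʳ v C) = appCʳ (ren f v) (renC f C)
renC f (jmpCʳ v C) = jmpCʳ (ren f v) (renC f C)
renC f (jmpCˡ C v) = jmpCˡ (renC f C) (ren f v)
renC f (lamC C)    = lamC (renC (ext f) C)

depthC-renC : ∀ f C → depthC (renC f C) ≡ depthC C
depthC-renC f □           = refl
depthC-renC f (appCˡ C v) = depthC-renC f C
depthC-renC f (appCʳ v C) = depthC-renC f C
depthC-renC f (jmpCʳ v C) = depthC-renC f C
depthC-renC f (jmpCˡ C v) = depthC-renC f C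
depthC-renC f (lamC C)    = cong suc (depthC-renC (ext f) C)

ren-⟨⟩ : ∀ f C t → ren f (C ⟨ t ⟩) ≡ renC f C ⟨ ren (extⁿ (depthC C) f) t ⟩
ren-⟨⟩ f □           t = refl
ren-⟨⟩ f (appCˡ C v) t = cong (λ z → app z (ren f v)) (ren-⟨⟩ f C t)
ren-⟨⟩ f (appCʳ v C) t = cong (app (ren f v)) (ren-⟨⟩ f C t)
ren-⟨⟩ f (jmpCʳ v C) t = cong (jmp (ren f v)) (ren-⟨⟩ f C t)
ren-⟨⟩ f (jmpCˡ C v) t = cong (λ z → jmp z (ren f v)) (ren-⟨⟩ f C t)
ren-⟨⟩ f (lamC C)    t = cong lam (ren-⟨⟩ (ext f) C t)

renB : (ℕ → ℕ) → BCtx → BCtx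
renB f (appBʳ t C) = appBʳ (ren f t) (renC f C)
renB f (jmpBʳ t C) = jmpBʳ (ren f t) (renC f C)
renB f (appBˡ B t) = appBˡ (renB f B) (ren f t)
renB f (jmpBˡ B t) = jmpBˡ (renB f B) (ren f t)
renB f (lamB B)    = lamB (renB (ext f) B)

depthB-renB : ∀ f B → depthB (renB f B) ≡ depthB B
depthB-renB f (appBʳ t C) = depthC-renC f C
depthB-renB f (jmpBʳ t C) = depthC-renC f C
depthB-renB f (appBˡ B t) = depthB-renB f B
depthB-renB f (jmpBˡ B t) = depthB-renB f B
depthB-renB f (lamB B)    = cong suc (depthB-renB (ext f) B)

ren-⟨⟩B : ∀ f B t → ren f (B ⟨ t ⟩B) ≡ renB f B ⟨ ren (extⁿ (depthB B) f) t ⟩B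
ren-⟨⟩B f (appBʳ u C) t = cong (app (ren f u)) (ren-⟨⟩ f C t)
ren-⟨⟩B f (jmpBʳ u C) t = cong (jmp (ren f u)) (ren-⟨⟩ f C t)
ren-⟨⟩B f (appBˡ B u) t = cong (λ z → app z (ren f u)) (ren-⟨⟩B f B t)
ren-⟨⟩B f (jmpBˡ B u) t = cong (λ z → jmp z (ren f u)) (ren-⟨⟩B f B t)
ren-⟨⟩B f (lamB B)    t = cong lam (ren-⟨⟩B (ext f) B t)

ren-⟪⟫ : ∀ f t L → ren f (t ⟪ L ⟫) ≡ ren f t ⟪ map (ren f) L ⟫
ren-⟪⟫ f t []      = refl
ren-⟪⟫ f t (u ∷ L) = ren-⟪⟫ f (jmp t u) L

ren-⟨⟩⁻ : ∀ f C x v → ren f v ≡ C ⟨ x ⟩ →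
          ∃[ C₀ ] ∃[ x₀ ] (v ≡ C₀ ⟨ x₀ ⟩ × renC f C₀ ≡ C × ren (extⁿ (depthC C₀) f) x₀ ≡ x)
ren-⟨⟩⁻ f □ x v eq = □ , v , refl , refl , eq
ren-⟨⟩⁻ f (appCˡ C w) x (app a b) eq with app-injective eq
... | e₁ , e₂ with ren-⟨⟩⁻ f C x a e₁
... | C₀ , x₀ , r₁ , r₂ , r₃ = appCˡ C₀ b , x₀ , cong (λ z → app z b) r₁ , cong₂ appCˡ r₂ e₂ , r₃
ren-⟨⟩⁻ f (appCʳ w C) x (app a b) eq with app-injective eq
... | e₁ , e₂ with ren-⟨⟩⁻ f C x b e₂
... | C₀ , x₀ , r₁ , r₂ , r₃ = appCʳ a C₀ , x₀ , cong (app a) r₁ , cong₂ appCʳ e₁ r₂ , r₃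
ren-⟨⟩⁻ f (jmpCʳ w C) x (jmp a b) eq with jmp-injective eq
... | e₁ , e₂ with ren-⟨⟩⁻ f C x b e₂
... | C₀ , x₀ , r₁ , r₂ , r₃ = jmpCʳ a C₀ , x₀ , cong (jmp a) r₁ , cong₂ jmpCʳ e₁ r₂ , r₃
ren-⟨⟩⁻ f (jmpCˡ C w) x (jmp a b) eq with jmp-injective eq
... | e₁ , e₂ with ren-⟨⟩⁻ f C x a e₁
... | C₀ , x₀ , r₁ , r₂ , r₃ = jmpCˡ C₀ b , x₀ , cong (λ z → jmp z b) r₁ , cong₂ jmpCˡ r₂ e₂ , r₃
ren-⟨⟩⁻ f (lamC C) x (lam a) eq with ren-⟨⟩⁻ (ext f) C x a (lam-injective eq)
... | C₀ , x₀ , r₁ , r₂ , r₃ = lamC C₀ , x₀ , cong lam r₁ , cong lamC r₂ , r₃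

ren-⟨⟩B⁻ : ∀ f B x v → ren f v ≡ B ⟨ x ⟩B →
           ∃[ B₀ ] ∃[ x₀ ] (v ≡ B₀ ⟨ x₀ ⟩B × renB f B₀ ≡ B × ren (extⁿ (depthB B₀) f) x₀ ≡ x)
ren-⟨⟩B⁻ f (appBʳ w C) x (app a b) eq with app-injective eq
... | e₁ , e₂ with ren-⟨⟩⁻ f C x b e₂
... | C₀ , x₀ , r₁ , r₂ , r₃ = appBʳ a C₀ , x₀ , cong (app a) r₁ , cong₂ appBʳ e₁ r₂ , r₃
ren-⟨⟩B⁻ f (jmpBʳ w C) x (jmp a b) eq with jmp-injective eq
... | e₁ , e₂ with ren-⟨⟩⁻ f C x b e₂
... | C₀ , x₀ , r₁ , r₂ , r₃ = jmpBʳ a C₀ , x₀ , cong (jmp a) r₁ , cong₂ jmpBʳ e₁ r₂ , r₃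
ren-⟨⟩B⁻ f (appBˡ B w) x (app a b) eq with app-injective eq
... | e₁ , e₂ with ren-⟨⟩B⁻ f B x a e₁
... | B₀ , x₀ , r₁ , r₂ , r₃ = appBˡ B₀ b , x₀ , cong (λ z → app z b) r₁ , cong₂ appBˡ r₂ e₂ , r₃
ren-⟨⟩B⁻ f (jmpBˡ B w) x (jmp a b) eq with jmp-injective eq
... | e₁ , e₂ with ren-⟨⟩B⁻ f B x a e₁
... | B₀ , x₀ , r₁ , r₂ , r₃ = jmpBˡ B₀ b , x₀ , cong (λ z → jmp z b) r₁ , cong₂ jmpBˡ r₂ e₂ , r₃
ren-⟨⟩B⁻ f (lamB B) x (lam a) eq with ren-⟨⟩B⁻ (ext f) B x a (lam-injective eq)
... | B₀ , x₀ , r₁ , r₂ , r₃ = lamB B₀ , x₀ , cong lam r₁ , cong lamB r₂ , r₃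

ren-⟪⟫⁻ : ∀ f L t w → ren f w ≡ t ⟪ L ⟫ →
          ∃[ t₀ ] ∃[ L₀ ] (w ≡ t₀ ⟪ L₀ ⟫ × ren f t₀ ≡ t × map (ren f) L₀ ≡ L)
ren-⟪⟫⁻ f []      t w eq = w , [] , refl , eq , refl
ren-⟪⟫⁻ f (u ∷ L) t w eq with ren-⟪⟫⁻ f L (jmp t u) w eq
... | jmp a b , L₀ , r₁ , r₂ , r₃ with jmp-injective r₂
... | e₁ , e₂ = a , b ∷ L₀ , r₁ , e₁ , cong₂ _∷_ e₂ r₃

<⊎+ : ∀ c n → n < c ⊎ ∃[ m ] (n ≡ c + m)
<⊎+ zero    n    = inj₂ (n , refl)
<⊎+ (suc c) zero = inj₁ (s≤s z≤n)
<⊎+ (suc c) (suc n) with <⊎+ c n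
... | inj₁ n<c      = inj₁ (s≤s n<c)
... | inj₂ (m , e)  = inj₂ (m , cong suc e)

<⇒≢+ : ∀ {a} c m → a < c → a ≢ c + m
<⇒≢+ c m a<c e = <-irrefl refl (≤-<-trans (m≤m+n c m) (subst (_< c) e a<c))

-- The right side avoids the variables c, …, c + d - 1, which the left renaming
-- fixes, so y avoids them too and is itself a shift.
ren-weaken⁻ : ∀ c d f y z → ren (extⁿ′ c (extⁿ d f)) y ≡ ren (extⁿ′ c (d +_)) z →
              ∃[ y₀ ] (y ≡ ren (extⁿ′ c (d +_)) y₀ × z ≡ ren (extⁿ′ c f) y₀)
ren-weaken⁻ c d f (var a) (var b) eq with var-injective eq | <⊎+ c a | <⊎+ c b
... | e | inj₁ a<c | inj₁ b<c =
  var a , cong var (sym (extⁿ′-< c _ a a<c)) ,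
  cong var (trans (sym (extⁿ′-< c _ b b<c)) (trans (sym e) (trans (extⁿ′-< c _ a a<c) (sym (extⁿ′-< c f a a<c)))))
... | e | inj₁ a<c | inj₂ (b′ , refl) =
  ⊥-elim (<⇒≢+ c (d + b′) a<c (trans (sym (extⁿ′-< c _ a a<c)) (trans e (extⁿ′-+ c _ b′))))
... | e | inj₂ (a′ , refl) | inj₁ b<c =
  ⊥-elim (<⇒≢+ c (extⁿ d f a′) b<c (trans (sym (extⁿ′-< c _ b b<c)) (trans (sym e) (extⁿ′-+ c _ a′))))
... | e | inj₂ (a′ , refl) | inj₂ (b′ , refl)
  with +-cancelˡ-≡ c _ _ (trans (sym (extⁿ′-+ c _ a′)) (trans e (extⁿ′-+ c _ b′))) | <⊎+ d a′
...   | e′ | inj₁ a′<d = ⊥-elim (<⇒≢+ d b′ (subst (_< d) (sym (extⁿ-< d f a′ a′<d)) a′<d) e′)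
...   | e′ | inj₂ (a″ , refl) =
  var (c + a″) , cong var (sym (extⁿ′-+ c _ a″)) ,
  cong var (trans (cong (c +_) (+-cancelˡ-≡ d _ _ (trans (sym e′) (extⁿ-+ d f a″)))) (sym (extⁿ′-+ c _ a″)))
ren-weaken⁻ c d f (lam y) (lam z) eq with ren-weaken⁻ (suc c) d f y z (lam-injective eq)
... | y₀ , r₁ , r₂ = lam y₀ , cong lam r₁ , cong lam r₂
ren-weaken⁻ c d f (app y y′) (app z z′) eq with app-injective eq
... | e₁ , e₂ with ren-weaken⁻ c d f y z e₁ | ren-weaken⁻ c d f y′ z′ e₂
... | y₀ , r₁ , r₂ | y₀′ , r₁′ , r₂′ = app y₀ y₀′ , cong₂ app r₁ r₁′ , cong₂ app r₂ r₂′
ren-weaken⁻ c d f (jmp y y′) (jmp z z′) eq with jmp-injective eq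
... | e₁ , e₂ with ren-weaken⁻ c d f y z e₁ | ren-weaken⁻ c d f y′ z′ e₂
... | y₀ , r₁ , r₂ | y₀′ , r₁′ , r₂′ = jmp y₀ y₀′ , cong₂ jmp r₁ r₁′ , cong₂ jmp r₂ r₂′

-- Subterms and size

SubAt-ren⁻ : ∀ f u {d a} → SubAt d a (ren f u) → ∃[ a₀ ] (SubAt d a₀ u × a ≡ ren (extⁿ d f) a₀)
SubAt-ren⁻ f u@(var _)   here = u , here , refl
SubAt-ren⁻ f u@(lam _)   here = u , here , refl
SubAt-ren⁻ f u@(app _ _) here = u , here , refl
SubAt-ren⁻ f u@(jmp _ _) here = u , here , refl
SubAt-ren⁻ f (lam u) (in-lam p) =
  let a₀ , q , e = SubAt-ren⁻ (ext f) u p in a₀ , in-lam q , e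
SubAt-ren⁻ f (app u v) (in-appˡ p) = let a₀ , q , e = SubAt-ren⁻ f u p in a₀ , in-appˡ q , e
SubAt-ren⁻ f (app u v) (in-appʳ p) = let a₀ , q , e = SubAt-ren⁻ f v p in a₀ , in-appʳ q , e
SubAt-ren⁻ f (jmp u v) (in-jmpˡ p) = let a₀ , q , e = SubAt-ren⁻ f u p in a₀ , in-jmpˡ q , e
SubAt-ren⁻ f (jmp u v) (in-jmpʳ p) = let a₀ , q , e = SubAt-ren⁻ f v p in a₀ , in-jmpʳ q , e

StrictSubAt-ren⁻ : ∀ f u {d a} → StrictSubAt d a (ren f u) →
                   ∃[ a₀ ] (StrictSubAt d a₀ u × a ≡ ren (extⁿ d f) a₀)
StrictSubAt-ren⁻ f (lam u) (s-lam p) =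
  let a₀ , q , e = SubAt-ren⁻ (ext f) u p in a₀ , s-lam q , e
StrictSubAt-ren⁻ f (app u v) (s-appˡ p) = let a₀ , q , e = SubAt-ren⁻ f u p in a₀ , s-appˡ q , e
StrictSubAt-ren⁻ f (app u v) (s-appʳ p) = let a₀ , q , e = SubAt-ren⁻ f v p in a₀ , s-appʳ q , e
StrictSubAt-ren⁻ f (jmp u v) (s-jmpˡ p) = let a₀ , q , e = SubAt-ren⁻ f u p in a₀ , s-jmpˡ q , e
StrictSubAt-ren⁻ f (jmp u v) (s-jmpʳ p) = let a₀ , q , e = SubAt-ren⁻ f v p in a₀ , s-jmpʳ q , e

StrictSubFv-ren⁻ : ∀ f u z → StrictSubFv z (ren f u) → ∃[ z₀ ] (StrictSubFv z₀ u × z ≡ ren f z₀)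
StrictSubFv-ren⁻ f u z (d , p) with StrictSubAt-ren⁻ f u p
... | a₀ , q , e with ren-weaken⁻ 0 d f a₀ z (sym e)
... | z₀ , refl , z≡ = z₀ , (d , q) , z≡

SubAt-ren : ∀ f {d a u} → SubAt d a u → SubAt d (ren (extⁿ d f) a) (ren f u)
SubAt-ren f here       = here
SubAt-ren f (in-lam p)  = in-lam (SubAt-ren (ext f) p)
SubAt-ren f (in-appˡ p) = in-appˡ (SubAt-ren f p)
SubAt-ren f (in-appʳ p) = in-appʳ (SubAt-ren f p)
SubAt-ren f (in-jmpˡ p) = in-jmpˡ (SubAt-ren f p)
SubAt-ren f (in-jmpʳ p) = in-jmpʳ (SubAt-ren f p)

StrictSubAt-ren : ∀ f {d a u} → StrictSubAt d a u → StrictSubAt d (ren (extⁿ d f) a) (ren f u)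
StrictSubAt-ren f (s-lam p)  = s-lam (SubAt-ren (ext f) p)
StrictSubAt-ren f (s-appˡ p) = s-appˡ (SubAt-ren f p)
StrictSubAt-ren f (s-appʳ p) = s-appʳ (SubAt-ren f p)
StrictSubAt-ren f (s-jmpˡ p) = s-jmpˡ (SubAt-ren f p)
StrictSubAt-ren f (s-jmpʳ p) = s-jmpʳ (SubAt-ren f p)

StrictSubFv-ren : ∀ f {z u} → StrictSubFv z u → StrictSubFv (ren f z) (ren f u)
StrictSubFv-ren f {z} {u} (d , p) =
  d , subst (λ w → StrictSubAt d w (ren f u)) (ren-weaken d f z) (StrictSubAt-ren f p)

StrictSubAt⇒SubAt : ∀ {d a b} → StrictSubAt d a b → SubAt d a b
StrictSubAt⇒SubAt (s-lam p)  = in-lam p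
StrictSubAt⇒SubAt (s-appˡ p) = in-appˡ p
StrictSubAt⇒SubAt (s-appʳ p) = in-appʳ p
StrictSubAt⇒SubAt (s-jmpˡ p) = in-jmpˡ p
StrictSubAt⇒SubAt (s-jmpʳ p) = in-jmpʳ p

SubAt-jmp⇒StrictSubAt : ∀ {d a b T} → SubAt d (jmp a b) T → StrictSubAt d b T
SubAt-jmp⇒StrictSubAt here       = s-jmpʳ here
SubAt-jmp⇒StrictSubAt (in-lam p)  = s-lam (StrictSubAt⇒SubAt (SubAt-jmp⇒StrictSubAt p))
SubAt-jmp⇒StrictSubAt (in-appˡ p) = s-appˡ (StrictSubAt⇒SubAt (SubAt-jmp⇒StrictSubAt p))
SubAt-jmp⇒StrictSubAt (in-appʳ p) = s-appʳ (StrictSubAt⇒SubAt (SubAt-jmp⇒StrictSubAt p))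
SubAt-jmp⇒StrictSubAt (in-jmpˡ p) = s-jmpˡ (StrictSubAt⇒SubAt (SubAt-jmp⇒StrictSubAt p))
SubAt-jmp⇒StrictSubAt (in-jmpʳ p) = s-jmpʳ (StrictSubAt⇒SubAt (SubAt-jmp⇒StrictSubAt p))

SubAt-⟨⟩ : ∀ C a → SubAt (depthC C) a (C ⟨ a ⟩)
SubAt-⟨⟩ □           a = here
SubAt-⟨⟩ (appCˡ C v) a = in-appˡ (SubAt-⟨⟩ C a)
SubAt-⟨⟩ (appCʳ v C) a = in-appʳ (SubAt-⟨⟩ C a)
SubAt-⟨⟩ (jmpCʳ v C) a = in-jmpʳ (SubAt-⟨⟩ C a)
SubAt-⟨⟩ (jmpCˡ C v) a = in-jmpˡ (SubAt-⟨⟩ C a)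
SubAt-⟨⟩ (lamC C)    a = in-lam (SubAt-⟨⟩ C a)

SubAt⇒⟨⟩ : ∀ {d a b} → SubAt d a b → ∃[ C ] (depthC C ≡ d × b ≡ C ⟨ a ⟩)
SubAt⇒⟨⟩ here = □ , refl , refl
SubAt⇒⟨⟩ (in-lam p) = let C , e₁ , e₂ = SubAt⇒⟨⟩ p in lamC C , cong suc e₁ , cong lam e₂
SubAt⇒⟨⟩ (in-appˡ {u = u} p) = let C , e₁ , e₂ = SubAt⇒⟨⟩ p in appCˡ C u , e₁ , cong (λ z → app z u) e₂
SubAt⇒⟨⟩ (in-appʳ {t = t} p) = let C , e₁ , e₂ = SubAt⇒⟨⟩ p in appCʳ t C , e₁ , cong (app t) e₂
SubAt⇒⟨⟩ (in-jmpˡ {u = u} p) = let C , e₁ , e₂ = SubAt⇒⟨⟩ p in jmpCˡ C u , e₁ , cong (λ z → jmp z u) e₂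
SubAt⇒⟨⟩ (in-jmpʳ {t = t} p) = let C , e₁ , e₂ = SubAt⇒⟨⟩ p in jmpCʳ t C , e₁ , cong (jmp t) e₂

StrictSubAt⇒⟨⟩ : ∀ {d a b} → StrictSubAt d a b →
                 ∃[ C ] (b ≡ C ⟨ a ⟩ × (∀ x → StrictSubAt d x (C ⟨ x ⟩)))
StrictSubAt⇒⟨⟩ (s-lam p) with SubAt⇒⟨⟩ p
... | C , refl , e = lamC C , cong lam e , λ x → s-lam (SubAt-⟨⟩ C x)
StrictSubAt⇒⟨⟩ (s-appˡ {u = u} p) with SubAt⇒⟨⟩ p
... | C , refl , e = appCˡ C u , cong (λ z → app z u) e , λ x → s-appˡ (SubAt-⟨⟩ C x)
StrictSubAt⇒⟨⟩ (s-appʳ {t = t} p) with SubAt⇒⟨⟩ p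
... | C , refl , e = appCʳ t C , cong (app t) e , λ x → s-appʳ (SubAt-⟨⟩ C x)
StrictSubAt⇒⟨⟩ (s-jmpˡ {u = u} p) with SubAt⇒⟨⟩ p
... | C , refl , e = jmpCˡ C u , cong (λ z → jmp z u) e , λ x → s-jmpˡ (SubAt-⟨⟩ C x)
StrictSubAt⇒⟨⟩ (s-jmpʳ {t = t} p) with SubAt⇒⟨⟩ p
... | C , refl , e = jmpCʳ t C , cong (jmp t) e , λ x → s-jmpʳ (SubAt-⟨⟩ C x)

size : Tm → ℕ
size (var x)   = 1
size (lam t)   = suc (size t)
size (app t u) = suc (size t + size u)
size (jmp t u) = suc (size t + size u)

size-ren : ∀ f t → size (ren f t) ≡ size t
size-ren f (var x)   = refl
size-ren f (lam t)   = cong suc (size-ren (ext f) t)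
size-ren f (app t u) = cong suc (cong₂ _+_ (size-ren f t) (size-ren f u))
size-ren f (jmp t u) = cong suc (cong₂ _+_ (size-ren f t) (size-ren f u))

size-SubAt : ∀ {d a b} → SubAt d a b → size a ≤ size b
size-SubAt here = ≤-refl
size-SubAt (in-lam p) = m≤n⇒m≤1+n (size-SubAt p)
size-SubAt {b = app t u} (in-appˡ p) = m≤n⇒m≤1+n (≤-trans (size-SubAt p) (m≤m+n (size t) (size u)))
size-SubAt {b = app t u} (in-appʳ p) = m≤n⇒m≤1+n (≤-trans (size-SubAt p) (m≤n+m (size u) (size t)))
size-SubAt {b = jmp t u} (in-jmpˡ p) = m≤n⇒m≤1+n (≤-trans (size-SubAt p) (m≤m+n (size t) (size u)))
size-SubAt {b = jmp t u} (in-jmpʳ p) = m≤n⇒m≤1+n (≤-trans (size-SubAt p) (m≤n+m (size u) (size t)))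

size-StrictSubAt : ∀ {d a b} → StrictSubAt d a b → size a < size b
size-StrictSubAt (s-lam p) = s≤s (size-SubAt p)
size-StrictSubAt {b = app t u} (s-appˡ p) = s≤s (≤-trans (size-SubAt p) (m≤m+n (size t) (size u)))
size-StrictSubAt {b = app t u} (s-appʳ p) = s≤s (≤-trans (size-SubAt p) (m≤n+m (size u) (size t)))
size-StrictSubAt {b = jmp t u} (s-jmpˡ p) = s≤s (≤-trans (size-SubAt p) (m≤m+n (size t) (size u)))
size-StrictSubAt {b = jmp t u} (s-jmpʳ p) = s≤s (≤-trans (size-SubAt p) (m≤n+m (size u) (size t)))

size-StrictSubFv : ∀ {z u} → StrictSubFv z u → size z < size u
size-StrictSubFv {z} (d , p) = subst (_< _) (size-ren (d +_) z) (size-StrictSubAt p)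

size-swap : ∀ t s v → suc (size t + size s + size v) ≡ suc (size t + size v + size s)
size-swap t s v = cong suc (trans (+-assoc (size t) (size s) (size v))
  (trans (cong (size t +_) (+-comm (size s) (size v))) (sym (+-assoc (size t) (size v) (size s)))))

size-~o : ∀ {a b} → a ~o b → size a ≡ size b
size-~o (ax-comm {t} {s} {v}) = cong suc (size-swap t s v)
size-~o (ax-lam {t} {s})      = cong (λ z → suc (suc (size t + z))) (size-ren suc s)
size-~o (ax-app {t} {s} {v})  = cong suc (size-swap t s v)

size-⟨⟩ : ∀ C {a b} → size a ≡ size b → size (C ⟨ a ⟩) ≡ size (C ⟨ b ⟩)
size-⟨⟩ □           e = e
size-⟨⟩ (appCˡ C v) e = cong (λ z → suc (z + size v)) (size-⟨⟩ C e)
size-⟨⟩ (appCʳ v C) e = cong (λ z → suc (size v + z)) (size-⟨⟩ C e)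
size-⟨⟩ (jmpCʳ v C) e = cong (λ z → suc (size v + z)) (size-⟨⟩ C e)
size-⟨⟩ (jmpCˡ C v) e = cong (λ z → suc (z + size v)) (size-⟨⟩ C e)
size-⟨⟩ (lamC C)    e = cong suc (size-⟨⟩ C e)

size-≡o : ∀ {a b} → a ≡o b → size a ≡ size b
size-≡o o-refl        = refl
size-≡o (o-sym p)     = sym (size-≡o p)
size-≡o (o-trans p q) = trans (size-≡o p) (size-≡o q)
size-≡o (o-ctx C r)   = size-⟨⟩ C (size-~o r)

-- Reduction, ≡o and renaming

ren-↦ : ∀ f {x y} → x ↦ y → ren f x ↦ ren f y
ren-↦ f (β {t} {L} {u} p) =
  subst₂ _↦_ (sym (cong (λ z → app z (ren f u)) (ren-⟪⟫ f (lam t) L)))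
    (sym (trans (ren-⟪⟫ f (t [0≔ u ]) L) (cong (_⟪ map (ren f) L ⟫) (ren-[0≔] f t u))))
    (β {ren (ext f) t} {map (ren f) L} {ren f u} (fv-ren t p))
ren-↦ f (dB {t} {L} {u} p) =
  subst₂ _↦_ (sym (cong (λ z → app z (ren f u)) (ren-⟪⟫ f (lam t) L)))
    (sym (trans (ren-⟪⟫ f (jmp (lower t) u) L)
                (cong (λ z → jmp z (ren f u) ⟪ map (ren f) L ⟫) (sym (lower-ren-ext f t p)))))
    (dB {ren (ext f) t} {map (ren f) L} {ren f u} (λ q → p (fv₀-ren-ext⁻ t q)))
ren-↦ f (h {t} {u} {us} ps) =
  subst (jmp (ren f t) (ren f u) ↦_) (sym (ren-⟪⟫ f t us)) (h (map⁺ (All.map (StrictSubFv-ren f) ps)))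
ren-↦ f (ur B {t} {u}) = subst₂ _↦_ lhs rhs (ur (renB f B))
  where
  n = depthB B
  lhs : renB f B ⟨ jmp (ren (extⁿ n f) t) (weaken (depthB (renB f B)) (ren f u)) ⟩B
      ≡ ren f (B ⟨ jmp t (weaken n u) ⟩B)
  lhs = sym (trans (ren-⟨⟩B f B (jmp t (weaken n u)))
        (cong (λ z → renB f B ⟨ jmp (ren (extⁿ n f) t) z ⟩B)
          (trans (ren-weaken n f u) (cong (λ k → weaken k (ren f u)) (sym (depthB-renB f B))))))
  rhs : jmp (renB f B ⟨ ren (extⁿ n f) t ⟩B) (ren f u) ≡ ren f (jmp (B ⟨ t ⟩B) u)
  rhs = cong (λ z → jmp z (ren f u)) (sym (ren-⟨⟩B f B t))

ren-⟶ : ∀ f {x y} → x ⟶ y → ren f x ⟶ ren f y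
ren-⟶ f (ctx C {x} {y} r) = subst₂ _⟶_ (sym (ren-⟨⟩ f C x)) (sym (ren-⟨⟩ f C y)) (ctx (renC f C) (ren-↦ _ r))

ren-~o : ∀ f {x y} → x ~o y → ren f x ~o ren f y
ren-~o f ax-comm          = ax-comm
ren-~o f (ax-lam {t} {s}) =
  subst (λ z → lam (jmp (ren (ext f) t) z) ~o jmp (lam (ren (ext f) t)) (ren f s)) (sym (ren-weaken 1 f s)) ax-lam
ren-~o f ax-app           = ax-app

ren-≡o : ∀ f {x y} → x ≡o y → ren f x ≡o ren f y
ren-≡o f o-refl        = o-refl
ren-≡o f (o-sym p)     = o-sym (ren-≡o f p)
ren-≡o f (o-trans p q) = o-trans (ren-≡o f p) (ren-≡o f q)
ren-≡o f (o-ctx C {x} {y} r) =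
  subst₂ _≡o_ (sym (ren-⟨⟩ f C x)) (sym (ren-⟨⟩ f C y)) (o-ctx (renC f C) (ren-~o _ r))

ren-⟶o : ∀ f {x y} → x ⟶o y → ren f x ⟶o ren f y
ren-⟶o f (a , b , p , r , q) = ren f a , ren f b , ren-≡o f p , ren-⟶ f r , ren-≡o f q

≡⇒≡o : ∀ {a b} → a ≡ b → a ≡o b
≡⇒≡o refl = o-refl

≡o-⟨⟩ : ∀ C {a b} → a ≡o b → C ⟨ a ⟩ ≡o C ⟨ b ⟩
≡o-⟨⟩ C o-refl        = o-refl
≡o-⟨⟩ C (o-sym p)     = o-sym (≡o-⟨⟩ C p)
≡o-⟨⟩ C (o-trans p q) = o-trans (≡o-⟨⟩ C p) (≡o-⟨⟩ C q)
≡o-⟨⟩ C (o-ctx D {x} {y} r) = subst₂ _≡o_ (⟨⟩-∘C C D x) (⟨⟩-∘C C D y) (o-ctx (C ∘C D) r)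

⟶-⟨⟩ : ∀ C {a b} → a ⟶ b → C ⟨ a ⟩ ⟶ C ⟨ b ⟩
⟶-⟨⟩ C (ctx D {x} {y} r) = subst₂ _⟶_ (⟨⟩-∘C C D x) (⟨⟩-∘C C D y) (ctx (C ∘C D) r)

⟶o-⟨⟩ : ∀ C {a b} → a ⟶o b → C ⟨ a ⟩ ⟶o C ⟨ b ⟩
⟶o-⟨⟩ C (a , b , p , r , q) = C ⟨ a ⟩ , C ⟨ b ⟩ , ≡o-⟨⟩ C p , ⟶-⟨⟩ C r , ≡o-⟨⟩ C q

≡o-⟶o : ∀ {a b c} → a ≡o b → b ⟶o c → a ⟶o c
≡o-⟶o e (x , y , p , r , q) = x , y , o-trans e p , r , q

⟶⇒⟶o : ∀ {a b} → a ⟶ b → a ⟶o b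
⟶⇒⟶o r = _ , _ , o-refl , r , o-refl

SN-≡o : ∀ {a b} → SN a → a ≡o b → SN b
SN-≡o (acc rs) e = acc (λ st → rs (≡o-⟶o e st))

SN-ren⁻ : ∀ f u → SN (ren f u) → SN u
SN-ren⁻ f u (acc rs) = acc (λ {u′} st → SN-ren⁻ f u′ (rs (ren-⟶o f st)))

⟪⟫-≡o : ∀ L {a b} → a ≡o b → a ⟪ L ⟫ ≡o b ⟪ L ⟫
⟪⟫-≡o L {a} {b} e = subst₂ _≡o_ (jumpsC-⟨⟩ L a) (jumpsC-⟨⟩ L b) (≡o-⟨⟩ (jumpsC L) e)

app-⟪⟫ : ∀ x b L → app (x ⟪ L ⟫) b ≡o app x b ⟪ L ⟫
app-⟪⟫ x b []      = o-refl
app-⟪⟫ x b (u ∷ L) = o-trans (app-⟪⟫ (jmp x u) b L) (⟪⟫-≡o L (o-ctx □ ax-app))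

jmp-⟪⟫ : ∀ x b L → jmp (x ⟪ L ⟫) b ≡o jmp x b ⟪ L ⟫
jmp-⟪⟫ x b []      = o-refl
jmp-⟪⟫ x b (u ∷ L) = o-trans (jmp-⟪⟫ (jmp x u) b L) (⟪⟫-≡o L (o-ctx □ ax-comm))

lam-⟪⟫ : ∀ x L → lam (x ⟪ map (weaken 1) L ⟫) ≡o lam x ⟪ L ⟫
lam-⟪⟫ x []      = o-refl
lam-⟪⟫ x (u ∷ L) = o-trans (lam-⟪⟫ (jmp x (weaken 1 u)) L) (⟪⟫-≡o L (o-ctx □ ax-lam))

lam-⟪weaken⟫ : ∀ s k L → lam (s ⟪ map (weaken (suc k)) L ⟫) ≡o lam s ⟪ map (weaken k) L ⟫
lam-⟪weaken⟫ s k L =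
  subst (λ M → lam (s ⟪ M ⟫) ≡o lam s ⟪ map (weaken k) L ⟫) (sym (map-weaken-suc k L)) (lam-⟪⟫ s (map (weaken k) L))

StrictSubFvs-ren⁻ : ∀ f b us → All (λ z → StrictSubFv z (ren f b)) us →
                    ∃[ us₀ ] (All (λ z → StrictSubFv z b) us₀ × map (ren f) us₀ ≡ us)
StrictSubFvs-ren⁻ f b []       []       = [] , [] , refl
StrictSubFvs-ren⁻ f b (z ∷ us) (p ∷ ps) with StrictSubFv-ren⁻ f b z p | StrictSubFvs-ren⁻ f b us ps
... | z₀ , q , e | us₀ , qs , es = z₀ ∷ us₀ , q ∷ qs , cong₂ _∷_ (sym e) es

ren-↦⁻ : ∀ f x₀ {x y} → ren f x₀ ≡ x → x ↦ y → ∃[ y₀ ] (x₀ ↦ y₀ × ren f y₀ ≡ y)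
ren-↦⁻ f (app a b) eq (β {t} {L} p) with app-injective eq
... | e₁ , refl with ren-⟪⟫⁻ f L (lam t) a e₁
... | lam t₀ , L₀ , refl , refl , refl =
  (t₀ [0≔ b ]) ⟪ L₀ ⟫ , β {L = L₀} (fv₀-ren-ext⁻ t₀ p) ,
  trans (ren-⟪⟫ f (t₀ [0≔ b ]) L₀) (cong (_⟪ map (ren f) L₀ ⟫) (ren-[0≔] f t₀ b))
ren-↦⁻ f (app a b) eq (dB {t} {L} p) with app-injective eq
... | e₁ , refl with ren-⟪⟫⁻ f L (lam t) a e₁
... | lam t₀ , L₀ , refl , refl , refl =
  jmp (lower t₀) b ⟪ L₀ ⟫ , dB {L = L₀} 0∉t₀ ,
  trans (ren-⟪⟫ f (jmp (lower t₀) b) L₀)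
        (cong (λ z → jmp z (ren f b) ⟪ map (ren f) L₀ ⟫) (sym (lower-ren-ext f t₀ 0∉t₀)))
  where
  0∉t₀ : ¬ (0 ∈fv t₀)
  0∉t₀ q = p (fv-ren {f = ext f} t₀ q)
ren-↦⁻ f (jmp a b) eq (h ps) with jmp-injective eq
... | refl , refl with StrictSubFvs-ren⁻ f b _ ps
... | us₀ , qs , refl = a ⟪ us₀ ⟫ , h qs , ren-⟪⟫ f a us₀
ren-↦⁻ f x₀ eq (ur B {t} {u}) with ren-⟨⟩B⁻ f B _ x₀ eq
... | B₀ , jmp p q , refl , refl , e₃ with jmp-injective e₃
... | refl , e₅ with ren-weaken⁻ 0 (depthB B₀) f q u (trans e₅ (cong (λ k → weaken k u) (depthB-renB f B₀)))
... | y₀ , refl , refl = jmp (B₀ ⟨ p ⟩B) y₀ , ur B₀ , cong (λ z → jmp z (ren f y₀)) (ren-⟨⟩B f B₀ p)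

ren-⟶⁻ : ∀ f v {a b} → ren f v ≡ a → a ⟶ b → ∃[ v′ ] (v ⟶ v′ × ren f v′ ≡ b)
ren-⟶⁻ f v eq (ctx C {x} r) with ren-⟨⟩⁻ f C x v eq
... | C₀ , x₀ , refl , refl , e₃ with ren-↦⁻ (extⁿ (depthC C₀) f) x₀ e₃ r
... | y₀ , r′ , refl = C₀ ⟨ y₀ ⟩ , ctx C₀ r′ , ren-⟨⟩ f C₀ y₀

ren-~o⁻ : ∀ f x₀ {x y} → ren f x₀ ≡ x → x ~o y → ∃[ y₀ ] (x₀ ~o y₀ × ren f y₀ ≡ y)
ren-~o⁻ f (jmp (jmp p q) r) eq ax-comm with jmp-injective eq
... | e₁ , refl with jmp-injective e₁
... | refl , refl = jmp (jmp p r) q , ax-comm , refl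
ren-~o⁻ f (lam (jmp p q)) eq (ax-lam {t} {s}) with jmp-injective (lam-injective eq)
... | refl , e₂ with ren-weaken⁻ 0 1 f q s e₂
... | y₀ , refl , refl = jmp (lam p) y₀ , ax-lam , refl
ren-~o⁻ f (app (jmp p q) r) eq ax-app with app-injective eq
... | e₁ , refl with jmp-injective e₁
... | refl , refl = jmp (app p r) q , ax-app , refl

ren-~o⁻-sym : ∀ f x₀ {x y} → ren f x₀ ≡ y → x ~o y → ∃[ y₀ ] (y₀ ~o x₀ × ren f y₀ ≡ x)
ren-~o⁻-sym f (jmp (jmp p q) r) eq ax-comm with jmp-injective eq
... | e₁ , refl with jmp-injective e₁
... | refl , refl = jmp (jmp p r) q , ax-comm , refl
ren-~o⁻-sym f (jmp (lam p) q) eq ax-lam with jmp-injective eq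
... | e₁ , refl with lam-injective e₁
... | refl = lam (jmp p (weaken 1 q)) , ax-lam , cong (λ z → lam (jmp (ren (ext f) p) z)) (ren-weaken 1 f q)
ren-~o⁻-sym f (jmp (app p r) q) eq ax-app with jmp-injective eq
... | e₁ , refl with app-injective e₁
... | refl , refl = app (jmp p q) r , ax-app , refl

_~o±_ : Tm → Tm → Set
x ~o± y = x ~o y ⊎ y ~o x

~o±⇒≡o : ∀ C {x y} → x ~o± y → C ⟨ x ⟩ ≡o C ⟨ y ⟩
~o±⇒≡o C (inj₁ r) = o-ctx C r
~o±⇒≡o C (inj₂ r) = o-sym (o-ctx C r)

ren-~o±⁻ : ∀ f v C {x y} → ren f v ≡ C ⟨ x ⟩ → x ~o± y → ∃[ v′ ] (v ≡o v′ × ren f v′ ≡ C ⟨ y ⟩)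
ren-~o±⁻ f v C {x} eq r with ren-⟨⟩⁻ f C x v eq
ren-~o±⁻ f v C eq (inj₁ r) | C₀ , x₀ , refl , refl , e₃ with ren-~o⁻ (extⁿ (depthC C₀) f) x₀ e₃ r
... | y₀ , r′ , refl = C₀ ⟨ y₀ ⟩ , o-ctx C₀ r′ , ren-⟨⟩ f C₀ y₀
ren-~o±⁻ f v C eq (inj₂ r) | C₀ , x₀ , refl , refl , e₃ with ren-~o⁻-sym (extⁿ (depthC C₀) f) x₀ e₃ r
... | y₀ , r′ , refl = C₀ ⟨ y₀ ⟩ , o-sym (o-ctx C₀ r′) , ren-⟨⟩ f C₀ y₀

-- A jump inserted on the spine

-- ≡o moves a jump only along λ-bodies, function positions and jump bodies,
-- so these are the positions where the jump [_/v] of s[_/v] can end up.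
data Inserted (v : Tm) : ℕ → Tm → Tm → Set where
  ins-here : ∀ {k x w} → w ≡ weaken k v → Inserted v k x (jmp x w)
  ins-lam  : ∀ {k s t} → Inserted v (suc k) s t → Inserted v k (lam s) (lam t)
  ins-app  : ∀ {k s t a} → Inserted v k s t → Inserted v k (app s a) (app t a)
  ins-jmp  : ∀ {k s t a} → Inserted v k s t → Inserted v k (jmp s a) (jmp t a)

Inserted≡o : Tm → ℕ → Tm → Tm → Set
Inserted≡o v k s t = ∃[ s′ ] ∃[ v′ ] (s ≡o s′ × v ≡o v′ × Inserted v′ k s′ t)

Inserted⇒Inserted≡o : ∀ {v k s t} → Inserted v k s t → Inserted≡o v k s t
Inserted⇒Inserted≡o p = _ , _ , o-refl , o-refl , p

Inserted≡o-trans : ∀ {v k s a b} → Inserted≡o v k s a →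
                   (∀ {v′ s′} → Inserted v′ k s′ a → Inserted≡o v′ k s′ b) → Inserted≡o v k s b
Inserted≡o-trans (s₁ , v₁ , e₁ , e₂ , p) g with g p
... | s₂ , v₂ , e₃ , e₄ , q = s₂ , v₂ , o-trans e₁ e₃ , o-trans e₂ e₄ , q

Inserted-~o : ∀ {v k s x y} → x ~o y → Inserted v k s x → Inserted≡o v k s y
Inserted-~o ax-comm (ins-here e)           = Inserted⇒Inserted≡o (ins-jmp (ins-here e))
Inserted-~o ax-comm (ins-jmp (ins-here e)) = Inserted⇒Inserted≡o (ins-here e)
Inserted-~o ax-comm (ins-jmp (ins-jmp q))  = _ , _ , o-ctx □ ax-comm , o-refl , ins-jmp (ins-jmp q)
Inserted-~o {v} {k} (ax-lam {t} {c}) (ins-lam (ins-here e)) =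
  Inserted⇒Inserted≡o (ins-here (ren-injective suc-injective c (weaken k v) (trans e (sym (weaken₁-weaken k v)))))
Inserted-~o ax-lam (ins-lam (ins-jmp q))   = _ , _ , o-ctx □ ax-lam , o-refl , ins-jmp (ins-lam q)
Inserted-~o ax-app (ins-app (ins-here e))  = Inserted⇒Inserted≡o (ins-here e)
Inserted-~o ax-app (ins-app (ins-jmp q))   = _ , _ , o-ctx □ ax-app , o-refl , ins-jmp (ins-app q)

Inserted-~o⁻ : ∀ {v k s x y} → y ~o x → Inserted v k s x → Inserted≡o v k s y
Inserted-~o⁻ ax-comm p = Inserted-~o ax-comm p
Inserted-~o⁻ {v} {k} ax-lam (ins-here e) =
  Inserted⇒Inserted≡o (ins-lam (ins-here (trans (cong (weaken 1) e) (weaken₁-weaken k v))))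
Inserted-~o⁻ ax-lam (ins-jmp (ins-lam q)) = _ , _ , o-sym (o-ctx □ ax-lam) , o-refl , ins-lam (ins-jmp q)
Inserted-~o⁻ ax-app (ins-here e)          = Inserted⇒Inserted≡o (ins-app (ins-here e))
Inserted-~o⁻ ax-app (ins-jmp (ins-app q)) = _ , _ , o-sym (o-ctx □ ax-app) , o-refl , ins-app (ins-jmp q)

Inserted-~o± : ∀ {v k s} C {x y} → x ~o± y → Inserted v k s (C ⟨ x ⟩) → Inserted≡o v k s (C ⟨ y ⟩)
Inserted-~o± □ (inj₁ r) p = Inserted-~o r p
Inserted-~o± □ (inj₂ r) p = Inserted-~o⁻ r p
Inserted-~o± (appCˡ C a) r (ins-app q) with Inserted-~o± C r q
... | s′ , v′ , e₁ , e₂ , q′ = app s′ a , v′ , ≡o-⟨⟩ (appCˡ □ a) e₁ , e₂ , ins-app q′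
Inserted-~o± (appCʳ a C) r (ins-app {s = s₀} q) = _ , _ , ~o±⇒≡o (appCʳ s₀ C) r , o-refl , ins-app q
Inserted-~o± (jmpCˡ C a) r (ins-here e) = _ , _ , ~o±⇒≡o C r , o-refl , ins-here e
Inserted-~o± (jmpCˡ C a) r (ins-jmp q) with Inserted-~o± C r q
... | s′ , v′ , e₁ , e₂ , q′ = jmp s′ a , v′ , ≡o-⟨⟩ (jmpCˡ □ a) e₁ , e₂ , ins-jmp q′
Inserted-~o± {v} {k} (jmpCʳ a C) r (ins-here e) with ren-~o±⁻ (k +_) v C (sym e) r
... | v′ , e₁ , e₂ = _ , v′ , o-refl , e₁ , ins-here (sym e₂)
Inserted-~o± (jmpCʳ a C) r (ins-jmp {s = s₀} q) = _ , _ , ~o±⇒≡o (jmpCʳ s₀ C) r , o-refl , ins-jmp q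
Inserted-~o± (lamC C) r (ins-lam q) with Inserted-~o± C r q
... | s′ , v′ , e₁ , e₂ , q′ = lam s′ , v′ , ≡o-⟨⟩ (lamC □) e₁ , e₂ , ins-lam q′

Inserted-≡o : ∀ {a b} → a ≡o b →
  (∀ {v k s} → Inserted v k s a → Inserted≡o v k s b) × (∀ {v k s} → Inserted v k s b → Inserted≡o v k s a)
Inserted-≡o o-refl = Inserted⇒Inserted≡o , Inserted⇒Inserted≡o
Inserted-≡o (o-sym e) = let f , g = Inserted-≡o e in g , f
Inserted-≡o (o-trans e₁ e₂) with Inserted-≡o e₁ | Inserted-≡o e₂
... | f₁ , g₁ | f₂ , g₂ = (λ p → Inserted≡o-trans (f₁ p) f₂) , (λ p → Inserted≡o-trans (g₂ p) g₁)
Inserted-≡o (o-ctx C r) = Inserted-~o± C (inj₁ r) , Inserted-~o± C (inj₂ r)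

Inserted-⟪⟫ : ∀ {v k a b} L → Inserted v k a b → Inserted v k (a ⟪ L ⟫) (b ⟪ L ⟫)
Inserted-⟪⟫ []      p = p
Inserted-⟪⟫ (u ∷ L) p = Inserted-⟪⟫ L (ins-jmp p)

Inserted-⟪++⟫ : ∀ {v k} L₁ L₂ x w → w ≡ weaken k v → Inserted v k (x ⟪ L₁ ++ L₂ ⟫) (x ⟪ L₁ ++ w ∷ L₂ ⟫)
Inserted-⟪++⟫ []       L₂ x w e = Inserted-⟪⟫ L₂ (ins-here e)
Inserted-⟪++⟫ (u ∷ L₁) L₂ x w e = Inserted-⟪++⟫ L₁ L₂ (jmp x u) w e

Inserted-⟪⟫-view : ∀ L {v k s x} → Inserted v k s (x ⟪ L ⟫) →
  (∃[ L₁ ] ∃[ L₂ ] ∃[ w ] (w ≡ weaken k v × L ≡ L₁ ++ w ∷ L₂ × s ≡ x ⟪ L₁ ++ L₂ ⟫))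
  ⊎ (∃[ x₀ ] (Inserted v k x₀ x × s ≡ x₀ ⟪ L ⟫))
Inserted-⟪⟫-view []      p = inj₂ (_ , p , refl)
Inserted-⟪⟫-view (u ∷ L) {x = x} p with Inserted-⟪⟫-view L {x = jmp x u} p
... | inj₁ (L₁ , L₂ , w , e , eL , es) = inj₁ (u ∷ L₁ , L₂ , w , e , cong (u ∷_) eL , es)
... | inj₂ (_ , ins-here e , es)       = inj₁ ([] , L , u , e , refl , es)
... | inj₂ (_ , ins-jmp {s = x₁} q , es) = inj₂ (x₁ , q , es)

Inserted-ren : ∀ {v k a b} → Inserted v k a b → ∀ ρ k′ → (∀ n → ρ (k + n) ≡ k′ + n) →
               Inserted v k′ (ren ρ a) (ren ρ b)
Inserted-ren {v} (ins-here e) ρ k′ ρ-shift = ins-here (trans (cong (ren ρ) e) (ren-ren ρ-shift v))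
Inserted-ren (ins-lam q) ρ k′ ρ-shift = ins-lam (Inserted-ren q (ext ρ) (suc k′) (λ n → cong suc (ρ-shift n)))
Inserted-ren (ins-app q) ρ k′ ρ-shift = ins-app (Inserted-ren q ρ k′ ρ-shift)
Inserted-ren (ins-jmp q) ρ k′ ρ-shift = ins-jmp (Inserted-ren q ρ k′ ρ-shift)

Inserted-sub : ∀ {v k a b} → Inserted v k a b → ∀ σ k′ → (∀ n → σ (k + n) ≡ var (k′ + n)) →
               Inserted v k′ (sub σ a) (sub σ b)
Inserted-sub {v} (ins-here e) σ k′ σ-shift =
  ins-here (trans (cong (sub σ) e) (trans (sub-ren (λ _ → refl) v) (sub-var≡ren σ-shift v)))
Inserted-sub (ins-lam q) σ k′ σ-shift = ins-lam (Inserted-sub q (exts σ) (suc k′) (λ n → cong (ren suc) (σ-shift n)))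
Inserted-sub (ins-app q) σ k′ σ-shift = ins-app (Inserted-sub q σ k′ σ-shift)
Inserted-sub (ins-jmp q) σ k′ σ-shift = ins-jmp (Inserted-sub q σ k′ σ-shift)

Inserted-[0≔] : ∀ {v k a b} u → Inserted v (suc k) a b → Inserted v k (a [0≔ u ]) (b [0≔ u ])
Inserted-[0≔] {v} {k} {a} {b} u q =
  subst₂ (Inserted v k) (sym ([0≔]≡sub-single a u)) (sym ([0≔]≡sub-single b u)) (Inserted-sub q (single u) k (λ n → refl))

Inserted-fv⁻ : ∀ {v k s t y} → Inserted v k s t → y ∈fv t → y < k → y ∈fv s
Inserted-fv⁻ (ins-here e) (fv-jmpˡ p) y<k = p
Inserted-fv⁻ {v} {k} (ins-here refl) (fv-jmpʳ p) y<k with fv-ren⁻ {f = k +_} v p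
... | x , _ , refl = ⊥-elim (<-irrefl refl (≤-<-trans (m≤m+n k x) y<k))
Inserted-fv⁻ (ins-lam q) (fv-lam p)  y<k = fv-lam (Inserted-fv⁻ q p (s≤s y<k))
Inserted-fv⁻ (ins-app q) (fv-appˡ p) y<k = fv-appˡ (Inserted-fv⁻ q p y<k)
Inserted-fv⁻ (ins-app q) (fv-appʳ p) y<k = fv-appʳ p
Inserted-fv⁻ (ins-jmp q) (fv-jmpˡ p) y<k = fv-jmpˡ (Inserted-fv⁻ q p y<k)
Inserted-fv⁻ (ins-jmp q) (fv-jmpʳ p) y<k = fv-jmpʳ p

Inserted-fv : ∀ {v k s t y} → Inserted v k s t → y ∈fv s → y ∈fv t
Inserted-fv (ins-here e) p = fv-jmpˡ p
Inserted-fv (ins-lam q) (fv-lam p)  = fv-lam (Inserted-fv q p)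
Inserted-fv (ins-app q) (fv-appˡ p) = fv-appˡ (Inserted-fv q p)
Inserted-fv (ins-app q) (fv-appʳ p) = fv-appʳ p
Inserted-fv (ins-jmp q) (fv-jmpˡ p) = fv-jmpˡ (Inserted-fv q p)
Inserted-fv (ins-jmp q) (fv-jmpʳ p) = fv-jmpʳ p

data Residue (v : Tm) : List Tm → Set where
  by-h : ∀ {L} → All (λ z → StrictSubFv z v) L → Residue v L
  by-u : ∀ {v′ z} → v ⟶ v′ → StrictSubFv z v → Residue v (v′ ∷ z ∷ [])

data JumpReduct (v : Tm) (k : ℕ) (s t : Tm) : Set where
  body-step : ∀ {s′} → s ⟶ s′ → Inserted v k s′ t → JumpReduct v k s t
  arg-step  : ∀ {v′} → v ⟶ v′ → Inserted v′ k s t → JumpReduct v k s t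
  consumed  : ∀ {L} → Residue v L → t ≡o s ⟪ map (weaken k) L ⟫ → JumpReduct v k s t

JumpReduct-app : ∀ {v k s t} a → JumpReduct v k s t → JumpReduct v k (app s a) (app t a)
JumpReduct-app a (body-step r q) = body-step (⟶-⟨⟩ (appCˡ □ a) r) (ins-app q)
JumpReduct-app a (arg-step r q)  = arg-step r (ins-app q)
JumpReduct-app {k = k} {s} a (consumed {L} res e) =
  consumed res (o-trans (≡o-⟨⟩ (appCˡ □ a) e) (app-⟪⟫ s a (map (weaken k) L)))

JumpReduct-jmp : ∀ {v k s t} a → JumpReduct v k s t → JumpReduct v k (jmp s a) (jmp t a)
JumpReduct-jmp a (body-step r q) = body-step (⟶-⟨⟩ (jmpCˡ □ a) r) (ins-jmp q)
JumpReduct-jmp a (arg-step r q)  = arg-step r (ins-jmp q)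
JumpReduct-jmp {k = k} {s} a (consumed {L} res e) =
  consumed res (o-trans (≡o-⟨⟩ (jmpCˡ □ a) e) (jmp-⟪⟫ s a (map (weaken k) L)))

JumpReduct-lam : ∀ {v k s t} → JumpReduct v (suc k) s t → JumpReduct v k (lam s) (lam t)
JumpReduct-lam (body-step r q) = body-step (⟶-⟨⟩ (lamC □) r) (ins-lam q)
JumpReduct-lam (arg-step r q)  = arg-step r (ins-lam q)
JumpReduct-lam {k = k} {s} (consumed {L} res e) =
  consumed res (o-trans (≡o-⟨⟩ (lamC □) e) (lam-⟪weaken⟫ s k L))

-- Rule u fired on a term with the jump [_/v] inserted: either it also fires,
-- through B₀, on the term without that jump, or the jump it extracts lies
-- inside v.
data UReduct (v : Tm) (k : ℕ) (s : Tm) (B : BCtx) (t u : Tm) : Set where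
  u-elsewhere : ∀ B₀ → depthB B₀ ≡ depthB B → s ≡ B₀ ⟨ jmp t (weaken (depthB B) u) ⟩B →
                Inserted v k (B₀ ⟨ t ⟩B) (B ⟨ t ⟩B) → UReduct v k s B t u
  u-inside-v  : ∀ {v′ z} → v ⟶ v′ → StrictSubFv z v →
                jmp (B ⟨ t ⟩B) u ≡o s ⟪ map (weaken k) (v′ ∷ z ∷ []) ⟫ → UReduct v k s B t u

Inserted-u : ∀ B {v k s t u} → Inserted v k s (B ⟨ jmp t (weaken (depthB B) u) ⟩B) → UReduct v k s B t u
Inserted-u (appBʳ a C) (ins-app {s = s₀} q) = u-elsewhere (appBʳ s₀ C) refl refl (ins-app q)
Inserted-u (jmpBʳ a C) (ins-jmp {s = s₀} q) = u-elsewhere (jmpBʳ s₀ C) refl refl (ins-jmp q)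
Inserted-u (jmpBʳ a C) {v} {k} {t = t} {u} (ins-here e)
  with ren-⟨⟩⁻ (k +_) C (jmp t (weaken (depthC C) u)) v (sym e)
... | C₀ , jmp p q , refl , refl , e₃ with jmp-injective e₃
... | refl , e₅ with ren-weaken⁻ 0 (depthC C₀) (k +_) q u (trans e₅ (cong (λ n → weaken n u) (depthC-renC (k +_) C₀)))
... | z , refl , refl =
  u-inside-v (ctx C₀ (h {us = []} [])) (depthC C₀ , SubAt-jmp⇒StrictSubAt (SubAt-⟨⟩ C₀ (jmp p (weaken (depthC C₀) z))))
    (≡⇒≡o (cong (λ w → jmp (jmp a w) (weaken k z)) (sym (ren-⟨⟩ (k +_) C₀ p))))
Inserted-u (appBˡ B a) {k = k} (ins-app {s = s₀} q) with Inserted-u B q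
... | u-elsewhere B₀ dep refl q′ = u-elsewhere (appBˡ B₀ a) dep refl (ins-app q′)
... | u-inside-v {v′} {z} st sz e =
  u-inside-v st sz (o-trans (o-sym (o-ctx □ ax-app)) (o-trans (≡o-⟨⟩ (appCˡ □ a) e) (app-⟪⟫ s₀ a (map (weaken k) (v′ ∷ z ∷ [])))))
Inserted-u (jmpBˡ B a) (ins-here e) = u-elsewhere B refl refl (ins-here e)
Inserted-u (jmpBˡ B a) {k = k} (ins-jmp {s = s₀} q) with Inserted-u B q
... | u-elsewhere B₀ dep refl q′ = u-elsewhere (jmpBˡ B₀ a) dep refl (ins-jmp q′)
... | u-inside-v {v′} {z} st sz e =
  u-inside-v st sz (o-trans (o-ctx □ ax-comm) (o-trans (≡o-⟨⟩ (jmpCˡ □ a) e) (jmp-⟪⟫ s₀ a (map (weaken k) (v′ ∷ z ∷ [])))))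
Inserted-u (lamB B) {v} {k} {t = t} {u} (ins-lam {s = s₀} q)
  with Inserted-u B {u = weaken 1 u}
         (subst (λ w → Inserted v (suc k) s₀ (B ⟨ jmp t w ⟩B)) (sym (weaken-weaken₁ (depthB B) u)) q)
... | u-elsewhere B₀ dep refl q′ =
  u-elsewhere (lamB B₀) (cong suc dep) (cong (λ w → lam (B₀ ⟨ jmp t w ⟩B)) (weaken-weaken₁ (depthB B) u)) (ins-lam q′)
... | u-inside-v {v′} {z} st sz e =
  u-inside-v st sz (o-trans (o-sym (o-ctx □ ax-lam)) (o-trans (≡o-⟨⟩ (lamC □) e) (lam-⟪weaken⟫ s₀ k (v′ ∷ z ∷ []))))

UReduct⇒JumpReduct : ∀ {v k s} B {t u} → UReduct v k s B t u → JumpReduct v k s (jmp (B ⟨ t ⟩B) u)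
UReduct⇒JumpReduct B {t} {u} (u-elsewhere B₀ dep refl q) =
  body-step (ctx □ (subst (λ n → B₀ ⟨ jmp t (weaken n u) ⟩B ↦ jmp (B₀ ⟨ t ⟩B) u) dep (ur B₀))) (ins-jmp q)
UReduct⇒JumpReduct B (u-inside-v st sz e) = consumed (by-u st sz) e

Inserted-↦ : ∀ {v k s x y} → x ↦ y → Inserted v k s x → JumpReduct v k s y
Inserted-↦ (β {t} {L} {u} p) (ins-app q) with Inserted-⟪⟫-view L q
... | inj₁ (L₁ , L₂ , w , e , refl , refl) =
  body-step (ctx □ (β {t} {L₁ ++ L₂} {u} p)) (Inserted-⟪++⟫ L₁ L₂ (t [0≔ u ]) w e)
... | inj₂ (_ , ins-lam {s = t₀} q′ , refl) =
  body-step (ctx □ (β {t₀} {L} {u} (Inserted-fv⁻ q′ p (s≤s z≤n)))) (Inserted-⟪⟫ L (Inserted-[0≔] u q′))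
Inserted-↦ {k = k} (dB {t} {L} {u} p) (ins-app q) with Inserted-⟪⟫-view L q
... | inj₁ (L₁ , L₂ , w , e , refl , refl) =
  body-step (ctx □ (dB {t} {L₁ ++ L₂} {u} p)) (Inserted-⟪++⟫ L₁ L₂ (jmp (lower t) u) w e)
... | inj₂ (_ , ins-lam {s = t₀} q′ , refl) =
  body-step (ctx □ (dB {t₀} {L} {u} (λ r → p (Inserted-fv q′ r))))
            (Inserted-⟪⟫ L (ins-jmp (Inserted-ren q′ pred k (λ n → refl))))
Inserted-↦ {v} {k} (h {us = us} ps) (ins-here refl) with StrictSubFvs-ren⁻ (k +_) v us ps
... | us₀ , qs , refl = consumed (by-h qs) o-refl
Inserted-↦ (h {us = us} ps) (ins-jmp q) = body-step (ctx □ (h ps)) (Inserted-⟪⟫ us q)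
Inserted-↦ (ur B) p = UReduct⇒JumpReduct B (Inserted-u B p)

Inserted-⟶ : ∀ {v k s} C {x y} → x ↦ y → Inserted v k s (C ⟨ x ⟩) → JumpReduct v k s (C ⟨ y ⟩)
Inserted-⟶ □ r p = Inserted-↦ r p
Inserted-⟶ (appCˡ C a) r (ins-app q) = JumpReduct-app a (Inserted-⟶ C r q)
Inserted-⟶ (appCʳ a C) r (ins-app {s = s₀} q) = body-step (ctx (appCʳ s₀ C) r) (ins-app q)
Inserted-⟶ (jmpCˡ C a) r (ins-here e) = body-step (ctx C r) (ins-here e)
Inserted-⟶ (jmpCˡ C a) r (ins-jmp q) = JumpReduct-jmp a (Inserted-⟶ C r q)
Inserted-⟶ {v} {k} (jmpCʳ a C) r (ins-here e) with ren-⟶⁻ (k +_) v (sym e) (ctx C r)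
... | v′ , st , e′ = arg-step st (ins-here (sym e′))
Inserted-⟶ (jmpCʳ a C) r (ins-jmp {s = s₀} q) = body-step (ctx (jmpCʳ s₀ C) r) (ins-jmp q)
Inserted-⟶ (lamC C) r (ins-lam q) = JumpReduct-lam (Inserted-⟶ C r q)

-- Strong normalisation of s[_/v]

data _⊑_ : Tm → Tm → Set where
  ⊑-≡o  : ∀ {v G} → v ≡o G → v ⊑ G
  ⊑-sub : ∀ {v b G} → StrictSubFv v b → b ⊑ G → v ⊑ G

⊑-respˡ-≡o : ∀ {v v′ G} → v ≡o v′ → v ⊑ G → v′ ⊑ G
⊑-respˡ-≡o e (⊑-≡o p) = ⊑-≡o (o-trans (o-sym e) p)
⊑-respˡ-≡o {v} {v′} e (⊑-sub (d , p) q) with StrictSubAt⇒⟨⟩ p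
... | C , refl , fill = ⊑-sub (d , fill (weaken d v′)) (⊑-respˡ-≡o (≡o-⟨⟩ C (ren-≡o (d +_) e)) q)

⊑-⟶o : ∀ {v v′ G} → v ⟶o v′ → v ⊑ G → ∃[ G′ ] (G ⟶o G′ × v′ ⊑ G′)
⊑-⟶o st (⊑-≡o e) = _ , ≡o-⟶o (o-sym e) st , ⊑-≡o o-refl
⊑-⟶o {v} {v′} st (⊑-sub (d , p) q) with StrictSubAt⇒⟨⟩ p
... | C , refl , fill with ⊑-⟶o (⟶o-⟨⟩ C (ren-⟶o (d +_) st)) q
... | G′ , st′ , q′ = G′ , st′ , ⊑-sub (d , fill (weaken d v′)) q′

SN-⟪⟫ : ∀ {P : Tm → Set} → (∀ z → P z → ∀ X → SN X → SN (jmp X (weaken 0 z))) →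
        ∀ L → All P L → ∀ X → SN X → SN (X ⟪ map (weaken 0) L ⟫)
SN-⟪⟫ SN-jmp-P []      []       X sX = sX
SN-⟪⟫ SN-jmp-P (z ∷ L) (pz ∷ ps) X sX = SN-⟪⟫ SN-jmp-P L ps (jmp X (weaken 0 z)) (SN-jmp-P z pz X sX)

SNInserted : Tm → Tm → Set
SNInserted v s = ∀ t → Inserted≡o v 0 s t → SN t

Inserted≡o-jmp : ∀ s v → Inserted≡o v 0 s (jmp s (weaken 0 v))
Inserted≡o-jmp s v = Inserted⇒Inserted≡o (ins-here refl)

Inserted≡o-≡o : ∀ {v s b t s₂ v₂} → s ≡o s₂ → v ≡o v₂ → Inserted v₂ 0 s₂ b → b ≡o t → Inserted≡o v 0 s t
Inserted≡o-≡o e-s e-v q e with proj₁ (Inserted-≡o e) q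
... | s₃ , v₃ , e₃ , e₄ , q₃ = s₃ , v₃ , o-trans e-s e₃ , o-trans e-v e₄ , q₃

-- The three induction hypotheses of the lexicographic induction on
-- (a reduct of G, a smaller term below G, a reduct of s).
IH-ancestor : Tm → Set
IH-ancestor G = ∀ {G′} → G ⟶o G′ → ∀ v′ → v′ ⊑ G′ → ∀ s → SN s → SNInserted v′ s

IH-size : Tm → Tm → Set
IH-size G v = ∀ z → size z < size v → z ⊑ G → ∀ s → SN s → SNInserted z s

IH-body : Tm → Tm → Set
IH-body v s = ∀ {s′} → s ⟶o s′ → SNInserted v s′

SNInserted-step : ∀ G v s → v ⊑ G → SN s → IH-ancestor G → IH-size G v → IH-body v s →
                  ∀ t → Inserted≡o v 0 s t → ∀ {w} → t ⟶o w → SN w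
SNInserted-step G v s v⊑G sn-s ih-G ih-size ih-s t (s₁ , v₁ , e-s₁ , e-v₁ , p) (a , b , e₁ , ctx C r , e₂)
  with proj₁ (Inserted-≡o e₁) p
... | s₂ , v₂ , e-s₂ , e-v₂ , p₂ = by-cases (Inserted-⟶ C r p₂)
  where
  e-s : s ≡o s₂
  e-s = o-trans e-s₁ e-s₂
  e-v : v ≡o v₂
  e-v = o-trans e-v₁ e-v₂
  v₂⊑G : v₂ ⊑ G
  v₂⊑G = ⊑-respˡ-≡o e-v v⊑G
  sn-s₂ : SN s₂
  sn-s₂ = SN-≡o sn-s e-s
  SN-jmp-sub : ∀ z → StrictSubFv z v₂ → ∀ x → SN x → SN (jmp x (weaken 0 z))
  SN-jmp-sub z z<v₂ x sn-x =
    ih-size z (subst (size z <_) (sym (size-≡o e-v)) (size-StrictSubFv z<v₂)) (⊑-sub z<v₂ v₂⊑G) x sn-x _ (Inserted≡o-jmp x z)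
  SN-arg-step : ∀ v′ → v₂ ⟶ v′ → ∀ x → SN x → SNInserted v′ x
  SN-arg-step v′ st x sn-x with ⊑-⟶o (⟶⇒⟶o st) v₂⊑G
  ... | G′ , G⟶G′ , v′⊑G′ = ih-G G⟶G′ v′ v′⊑G′ x sn-x
  by-cases : JumpReduct v₂ 0 s₂ b → SN _
  by-cases (body-step st q) = ih-s (≡o-⟶o e-s (⟶⇒⟶o st)) _ (Inserted≡o-≡o o-refl e-v q e₂)
  by-cases (arg-step st q)  = SN-arg-step _ st s sn-s _ (Inserted≡o-≡o e-s o-refl q e₂)
  by-cases (consumed {L} (by-h zs) e) = SN-≡o (SN-⟪⟫ SN-jmp-sub L zs s₂ sn-s₂) (o-trans (o-sym e) e₂)
  by-cases (consumed (by-u {v′} {z} st z<v₂) e) =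
    SN-≡o (SN-jmp-sub z z<v₂ _ (SN-arg-step v′ st s₂ sn-s₂ _ (Inserted≡o-jmp s₂ v′))) (o-trans (o-sym e) e₂)

SNInserted-⊑ : ∀ G → SN G → ∀ v → Acc _<_ (size v) → v ⊑ G → ∀ s → SN s → SNInserted v s
SNInserted-⊑ G sn-G@(acc rs-G) v acc-v@(acc rs-v) v⊑G s sn-s@(acc rs-s) t p =
  acc (SNInserted-step G v s v⊑G sn-s
        (λ G⟶G′ v′ v′⊑G′ → SNInserted-⊑ _ (rs-G G⟶G′) v′ (<-wellFounded (size v′)) v′⊑G′)
        (λ z z<v z⊑G → SNInserted-⊑ G sn-G z (rs-v z<v) z⊑G)
        (λ s⟶s′ → SNInserted-⊑ G sn-G v acc-v v⊑G _ (rs-s s⟶s′))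
        t p)

SN-jmp : ∀ s v → SN s → SN v → SN (jmp s (weaken 0 v))
SN-jmp s v sn-s sn-v = SNInserted-⊑ v sn-v v (<-wellFounded (size v)) (⊑-≡o o-refl) s sn-s _ (Inserted≡o-jmp s v)

-- The trunk decomposition

∨≡false⁻ : ∀ a b → a ∨ b ≡ false → a ≡ false × b ≡ false
∨≡false⁻ false b e = refl , e

meetsΓ≡false⇒weaken : ∀ d c u → meetsΓ d c u ≡ false → ∃[ u₀ ] (u ≡ ren (extⁿ′ c (d +_)) u₀)
meetsΓ≡false⇒weaken d c (var k) e with k <ᵇ c in k<ᵇc
... | true = var k , cong var (sym (extⁿ′-< c _ k (<ᵇ⇒< k c (subst T (sym k<ᵇc) tt))))
... | false with <⊎+ c k
...   | inj₁ k<c = ⊥-elim (subst T k<ᵇc (<⇒<ᵇ k<c))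
...   | inj₂ (m , refl) with <⊎+ d m
...     | inj₁ m<d = ⊥-elim (subst T (trans (cong (_<ᵇ d) (sym (m+n∸m≡n c m))) e) (<⇒<ᵇ m<d))
...     | inj₂ (m′ , refl) = var (c + m′) , cong var (sym (extⁿ′-+ c _ m′))
meetsΓ≡false⇒weaken d c (lam u) e =
  let u₀ , r = meetsΓ≡false⇒weaken d (suc c) u e in lam u₀ , cong lam r
meetsΓ≡false⇒weaken d c (app u v) e with ∨≡false⁻ _ _ e
... | e₁ , e₂ with meetsΓ≡false⇒weaken d c u e₁ | meetsΓ≡false⇒weaken d c v e₂
... | u₀ , r₁ | v₀ , r₂ = app u₀ v₀ , cong₂ app r₁ r₂
meetsΓ≡false⇒weaken d c (jmp u v) e with ∨≡false⁻ _ _ e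
... | e₁ , e₂ with meetsΓ≡false⇒weaken d c u e₁ | meetsΓ≡false⇒weaken d c v e₂
... | u₀ , r₁ | v₀ , r₂ = jmp u₀ v₀ , cong₂ jmp r₁ r₂

trunk-decomposition : ∀ d t → sn d t → ∃[ L ] (All SN L × t ≡o tr d t ⟪ map (weaken d) L ⟫)
trunk-decomposition d (var x) _ = [] , [] , o-refl
trunk-decomposition d (app a b) sn-a with trunk-decomposition d a sn-a
... | L , sn-L , e = L , sn-L , o-trans (≡o-⟨⟩ (appCˡ □ b) e) (app-⟪⟫ (tr d a) b (map (weaken d) L))
trunk-decomposition d (lam a) sn-a with trunk-decomposition (suc d) a sn-a
... | L , sn-L , e = L , sn-L , o-trans (≡o-⟨⟩ (lamC □) e) (lam-⟪weaken⟫ (tr (suc d) a) d L)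
trunk-decomposition d (jmp a u) sn-au with meetsΓ d 0 u in meets
... | true with trunk-decomposition d a sn-au
...   | L , sn-L , e = L , sn-L , o-trans (≡o-⟨⟩ (jmpCˡ □ u) e) (jmp-⟪⟫ (tr d a) u (map (weaken d) L))
trunk-decomposition d (jmp a u) (sn-a , sn-u) | false
  with trunk-decomposition d a sn-a | meetsΓ≡false⇒weaken d 0 u meets
...   | L , sn-L , e | u₀ , refl =
  L ++ u₀ ∷ [] , ++⁺ sn-L (SN-ren⁻ (d +_) u₀ sn-u ∷ []) ,
  o-trans (≡o-⟨⟩ (jmpCˡ □ (weaken d u₀)) e)
    (≡⇒≡o (sym (trans (cong (tr d a ⟪_⟫) (map-++ (weaken d) L (u₀ ∷ []))) (⟪⟫-++ (tr d a) (map (weaken d) L) _))))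

theorem5p13 : ∀ (t : Tm) → SN (tr 0 t) → sn 0 t → SN t
theorem5p13 t sn-trunk sn-t =
  let L , sn-L , t≡trunk⟪L⟫ = trunk-decomposition 0 t sn-t
  in SN-≡o (SN-⟪⟫ (λ v sn-v s sn-s → SN-jmp s v sn-s sn-v) L sn-L (tr 0 t) sn-trunk) (o-sym t≡trunk⟪L⟫)
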